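{- Let $G$ be a finite graph, $r\ge 1$, and let $v\in V(G)$ be such that every vertex of $N(v)$ is adjacent to every vertex of $N_2(v)$. If $r > |N(v)|$, then $\mathrm{Supp}_r(v,G)$ is connected. In particular, $\tilde{H}_i(\mathrm{Ind}_r(G))=0$ for all $i<r-1$ and $\tilde{H}_j(\mathrm{Ind}_r(G))$ is torsion-free for $j=r-1,r$.
   Context: $N(v)$ is the set of neighbours of $v$ and $N_2(v)=\{w\in V(G): d(v,w)=2\}$. An $r$-support of $v$ is a set $S\subseteq V(G)$ with $v\notin S$, $|S|=r$ and $G[S\cup\{v\}]$ connected; $\mathrm{Supp}_r(v,G)$ is the set of all $r$-supports of $v$, and it is called connected if $G[S]$ is connected for every $S\in\mathrm{Supp}_r(v,G)$. $\mathrm{Ind}_r(G)$ is the simplicial complex on $V(G)$ whose simplices are the sets $A\subseteq V(G)$ such that every connected component of $G[A]$ has at most $r$ vertices. $\tilde{H}$ denotes reduced homology with integer coefficients. -}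

module Defs where

open import Data.Nat using (ℕ; zero; suc; _≤_; _<_; _<ᵇ_)
open import Data.Bool using (Bool; true; false; if_then_else_)
open import Data.Fin using (Fin; zero; suc; toℕ)
open import Data.Fin.Subset using (Subset; _∈_; _∉_; _∪_; ⁅_⁆; ∣_∣)
open import Data.Vec using (lookup; tabulate)
open import Data.Integer using (ℤ; +_; -_; _+_; _*_; 0ℤ; 1ℤ)
open import Data.Product using (Σ; _×_; ∃)
open import Relation.Nullary using (¬_)
open import Relation.Binary.PropositionalEquality using (_≡_; _≢_)
open import Function.Bundles using (_⇔_)

record Graph (n : ℕ) : Set where
  field
    adj    : Fin n → Fin n → Bool
    sym    : ∀ x y → adj x y ≡ adj y x
    irrefl : ∀ x → adj x x ≡ false

module _ {n : ℕ} (G : Graph n) where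
  open Graph G

  Adj : Fin n → Fin n → Set
  Adj x y = adj x y ≡ true

  data Walk (S : Subset n) : Fin n → Fin n → Set where
    here : ∀ {x} → x ∈ S → Walk S x x
    step : ∀ {x y z} → x ∈ S → Adj x y → Walk S y z → Walk S x z

  Connected : Subset n → Set
  Connected S = ∀ x y → x ∈ S → y ∈ S → Walk S x y

  Nbhd : Fin n → Subset n
  Nbhd v = tabulate (λ w → adj v w)

  InN₂ : Fin n → Fin n → Set
  InN₂ v w = (w ≢ v) × (adj v w ≡ false) × ∃ (λ u → Adj v u × Adj u w)

  IsSupport : ℕ → Fin n → Subset n → Set
  IsSupport r v S = (v ∉ S) × (∣ S ∣ ≡ r) × Connected (S ∪ ⁅ v ⁆)

  SuppConnected : ℕ → Fin n → Set
  SuppConnected r v = ∀ S → IsSupport r v S → Connected S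

  Component : Subset n → Fin n → Subset n → Set
  Component A x T = ∀ y → (y ∈ T) ⇔ ((y ∈ A) × Walk A x y)

  IsSimplex : ℕ → Subset n → Set
  IsSimplex r A = ∀ x T → x ∈ A → Component A x T → ∣ T ∣ ≤ r

  -- Augmented simplicial chains of Ind_r(G) with ℤ coefficients.
  -- A k-chain (homological degree k-1) is a function on vertex subsets,
  -- supported on simplices with exactly k vertices (k = 0 : the empty simplex).
  IsChain : ℕ → ℕ → (Subset n → ℤ) → Set
  IsChain r k c = ∀ A → ¬ (IsSimplex r A × ∣ A ∣ ≡ k) → c A ≡ 0ℤ

sumFin : ∀ {n} → (Fin n → ℤ) → ℤ
sumFin {zero} f = 0ℤ
sumFin {suc n} f = f zero + sumFin (λ i → f (suc i))

sgn : ℕ → ℤ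
sgn zero = 1ℤ
sgn (suc k) = - sgn k

module _ {n : ℕ} where
  below : Fin n → Subset n → ℕ
  below x B = ∣ tabulate (λ y → if lookup B y then (toℕ y <ᵇ toℕ x) else false) ∣

  -- simplicial boundary (vertices oriented by the order of Fin n):
  -- (∂c)(B) = Σ_{x ∉ B} (-1)^{#{y∈B : y<x}} c(B ∪ {x})
  ∂ : (Subset n → ℤ) → Subset n → ℤ
  ∂ c B = sumFin (λ x → if lookup B x then 0ℤ else sgn (below x B) * c (B ∪ ⁅ x ⁆))

module _ {n : ℕ} (G : Graph n) (r : ℕ) where
  IsCycle : ℕ → (Subset n → ℤ) → Set
  IsCycle k c = IsChain G r k c × (∀ B → ∂ c B ≡ 0ℤ)

  IsBoundary : ℕ → (Subset n → ℤ) → Set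
  IsBoundary k c = Σ (Subset n → ℤ) (λ d → IsChain G r (suc k) d × (∀ A → ∂ d A ≡ c A))

  -- H̃_{k-1}(Ind_r(G); ℤ) = 0
  ReducedHomologyVanishes : ℕ → Set
  ReducedHomologyVanishes k = ∀ c → IsCycle k c → IsBoundary k c

  -- H̃_{k-1}(Ind_r(G); ℤ) is torsion-free
  ReducedHomologyTorsionFree : ℕ → Set
  ReducedHomologyTorsionFree k =
    ∀ (m : ℕ) c → 1 ≤ m → IsCycle k c → IsBoundary k (λ A → + m * c A) → IsBoundary k c

-- If S is an r-support of v with r > |N(v)|, some vertex of S lies outside
-- N(v), so a walk from v to it inside S ∪ {v} passes through a vertex q ∈ S ∩ N₂(v).  Any
-- x ∈ S walks to v inside S ∪ {v}; the vertex just before v is a neighbour of v, hence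
-- adjacent to q, so the walk can be rerouted to q inside S: S is connected.
--
-- Every set of at most r vertices is a simplex of Ind_r(G), so in degrees below r − 1 every
-- cycle z is the boundary of its cone from v.  In the top two degrees the cone of z is still
-- a chain provided z vanishes on the faces B ∌ v with B ∪ {v} not a simplex.  Such B is an
-- r-support of v or, by the support lemma, an r-support S together with a vertex w adjacent
-- to nothing in S ∪ {v}.  An explicit chain Ψ z, which adds to each such face the first vertex far
-- from its "core", satisfies ∂(Ψ z) = z on these faces; then z − ∂(Ψ z) cones off.  The
-- torsion hypothesis m z = ∂ d enters only for an r-support without any far vertex: then
-- every coface of it is a non-simplex, so m z(B) = (∂ d)(B) = 0.

module Submission where

open import Defs
open import Data.Nat as N using (ℕ; zero; suc; _≤_; _<_; z≤n; s≤s; _<ᵇ_)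
open import Data.Nat.Properties as NP using ()
open import Data.Bool as B using (Bool; true; false; _∨_; _∧_; not; if_then_else_)
open import Data.Bool.Properties as BP using ()
open import Data.Fin using (Fin; zero; suc; toℕ; _≟_)
open import Data.Fin.Properties as FP using ()
open import Data.Fin.Subset as S using (Subset; _∈_; _∉_; _⊆_; _∪_; ⁅_⁆; _─_; ∣_∣)
open import Data.Fin.Subset.Properties as SP using (_∈?_)
open import Data.Vec using ([]; _∷_; lookup; tabulate)
open import Data.Vec.Properties as VP using ()
open import Data.Integer as Z using (ℤ; +_; -_; _+_; _*_; 0ℤ; 1ℤ)
open import Data.Integer.Properties as ZP using ()
open import Data.Integer.Tactic.RingSolver using (solve-∀)
open import Data.Product using (Σ; _×_; _,_; proj₁; proj₂)
open import Data.Sum using (_⊎_; inj₁; inj₂)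
open import Data.Empty using (⊥-elim)
open import Data.Maybe as M using (Maybe; just; nothing)
open import Relation.Nullary using (¬_; Dec; yes; no; does)
open import Relation.Nullary.Decidable using (_×-dec_; ¬?; decidable-stable; ¬¬-excluded-middle; dec-true; dec-false)
open import Relation.Nullary.Negation using (DoubleNegation; ¬¬-Monad)
open import Relation.Binary.PropositionalEquality
open import Function using (_∘_)
open import Function.Bundles using (mk⇔; Equivalence)
open import Effect.Monad using (RawMonad)
open import Level using (0ℓ)


true≢false : true ≢ false
true≢false ()

∧-trueˡ : ∀ {a b} → (a ∧ b) ≡ true → a ≡ true
∧-trueˡ {true} e = refl

∧-trueʳ : ∀ {a b} → (a ∧ b) ≡ true → b ≡ true
∧-trueʳ {true} e = e

∧-true : ∀ {a b} → a ≡ true → b ≡ true → (a ∧ b) ≡ true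
∧-true refl refl = refl

bool-cases : ∀ {ℓ} {P : Set ℓ} (b : Bool) → (b ≡ true → P) → (b ≡ false → P) → P
bool-cases true f g = f refl
bool-cases false f g = g refl

not-true⁻ : ∀ {a} → not a ≡ true → a ≡ false
not-true⁻ {false} e = refl

not-false⁺ : ∀ {a} → a ≡ false → not a ≡ true
not-false⁺ refl = refl

∨-true⁻ : ∀ {a b} → (a ∨ b) ≡ true → a ≡ true ⊎ b ≡ true
∨-true⁻ {true} e = inj₁ refl
∨-true⁻ {false} e = inj₂ e


anyᶠ : ∀ {n} → (Fin n → Bool) → Bool
anyᶠ {zero} f = false
anyᶠ {suc n} f = f zero ∨ anyᶠ (f ∘ suc)

anyᶠ-intro : ∀ {n} (f : Fin n → Bool) i → f i ≡ true → anyᶠ f ≡ true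
anyᶠ-intro f zero e rewrite e = refl
anyᶠ-intro f (suc i) e rewrite anyᶠ-intro (f ∘ suc) i e = BP.∨-zeroʳ (f zero)

anyᶠ-false : ∀ {n} (f : Fin n → Bool) → anyᶠ f ≡ false → ∀ i → f i ≡ false
anyᶠ-false f e i with f i in fi
... | false = refl
... | true with trans (sym (anyᶠ-intro f i fi)) e
...   | ()

anyᶠ-none : ∀ {n} (f : Fin n → Bool) → (∀ i → f i ≡ false) → anyᶠ f ≡ false
anyᶠ-none {zero} f h = refl
anyᶠ-none {suc n} f h rewrite h zero = anyᶠ-none (f ∘ suc) (h ∘ suc)

anyᶠ-witness : ∀ {n} (f : Fin n → Bool) → anyᶠ f ≡ true → Σ (Fin n) λ i → f i ≡ true
anyᶠ-witness {suc n} f e with f zero in f0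
... | true = zero , f0
... | false = let (i , p) = anyᶠ-witness (f ∘ suc) e in suc i , p

firstᶠ : ∀ {n} → (Fin n → Bool) → Maybe (Fin n)
firstᶠ {zero} f = nothing
firstᶠ {suc n} f = if f zero then just zero else M.map suc (firstᶠ (f ∘ suc))

firstᶠ-just : ∀ {n} (f : Fin n → Bool) a → firstᶠ f ≡ just a → f a ≡ true
firstᶠ-just {suc n} f a e with f zero in f0
firstᶠ-just {suc n} f zero refl | true = f0
firstᶠ-just {suc n} f a e | false with firstᶠ (f ∘ suc) in e2
firstᶠ-just {suc n} f .(suc b) refl | false | just b = firstᶠ-just (f ∘ suc) b e2

firstᶠ-nothing : ∀ {n} (f : Fin n → Bool) → firstᶠ f ≡ nothing → ∀ i → f i ≡ false
firstᶠ-nothing {suc n} f e i with f zero in f0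
firstᶠ-nothing {suc n} f () i | true
... | false with firstᶠ (f ∘ suc) in e2
firstᶠ-nothing {suc n} f refl zero | false | nothing = f0
firstᶠ-nothing {suc n} f refl (suc i) | false | nothing = firstᶠ-nothing (f ∘ suc) e2 i

selectsᵇ : ∀ {n} → Maybe (Fin n) → Fin n → Bool
selectsᵇ nothing x = false
selectsᵇ (just a) x = does (a ≟ x)

selectsᵇ-sound : ∀ {n} (m : Maybe (Fin n)) x → selectsᵇ m x ≡ true → m ≡ just x
selectsᵇ-sound nothing x ()
selectsᵇ-sound (just a) x e with a ≟ x
... | yes refl = refl
selectsᵇ-sound (just a) x () | no _

selectsᵇ-self : ∀ {n} (x : Fin n) → selectsᵇ (just x) x ≡ true
selectsᵇ-self x with x ≟ x
... | yes _ = refl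
... | no ne = ⊥-elim (ne refl)

selectsᵇ-other : ∀ {n} (a x : Fin n) → a ≢ x → selectsᵇ (just a) x ≡ false
selectsᵇ-other a x ne with a ≟ x
... | yes e = ⊥-elim (ne e)
... | no _ = refl

if-selectsᵇ-self : ∀ {n} {A : Set} (x : Fin n) (t e : A) → (if selectsᵇ (just x) x then t else e) ≡ t
if-selectsᵇ-self x t e rewrite selectsᵇ-self x = refl

if-selectsᵇ-other : ∀ {n} {A : Set} (a x : Fin n) (t e : A) → a ≢ x → (if selectsᵇ (just a) x then t else e) ≡ e
if-selectsᵇ-other a x t e a≢x rewrite selectsᵇ-other a x a≢x = refl


-- Subsets of Fin n as Boolean vectors

insert : ∀ {n} → Subset n → Fin n → Subset n
insert A x = A ∪ ⁅ x ⁆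

remove : ∀ {n} → Subset n → Fin n → Subset n
remove A x = A ─ ⁅ x ⁆

lookup-∪ : ∀ {n} (p q : Subset n) i → lookup (p ∪ q) i ≡ (lookup p i ∨ lookup q i)
lookup-∪ p q i = VP.lookup-zipWith _∨_ i p q

lookup-─ : ∀ {n} (p q : Subset n) i → lookup (p ─ q) i ≡ (lookup p i ∧ not (lookup q i))
lookup-─ (a ∷ p) (true ∷ q) zero = sym (BP.∧-zeroʳ a)
lookup-─ (a ∷ p) (false ∷ q) zero = sym (BP.∧-identityʳ a)
lookup-─ (a ∷ p) (true ∷ q) (suc i) = lookup-─ p q i
lookup-─ (a ∷ p) (false ∷ q) (suc i) = lookup-─ p q i

lookup-⊥ : ∀ {n} (i : Fin n) → lookup (S.⊥ {n}) i ≡ false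
lookup-⊥ i = VP.lookup-replicate i false

lookup-⁅x⁆-x : ∀ {n} (x : Fin n) → lookup ⁅ x ⁆ x ≡ true
lookup-⁅x⁆-x zero = refl
lookup-⁅x⁆-x (suc x) = lookup-⁅x⁆-x x

lookup-⁅x⁆-≢ : ∀ {n} (x i : Fin n) → i ≢ x → lookup ⁅ x ⁆ i ≡ false
lookup-⁅x⁆-≢ zero zero ne = ⊥-elim (ne refl)
lookup-⁅x⁆-≢ zero (suc i) ne = lookup-⊥ i
lookup-⁅x⁆-≢ (suc x) zero ne = refl
lookup-⁅x⁆-≢ (suc x) (suc i) ne = lookup-⁅x⁆-≢ x i (λ e → ne (cong suc e))

subset-ext : ∀ {n} (p q : Subset n) → (∀ i → lookup p i ≡ lookup q i) → p ≡ q
subset-ext [] [] h = refl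
subset-ext (a ∷ p) (b ∷ q) h = cong₂ _∷_ (h zero) (subset-ext p q (λ i → h (suc i)))

∈⇒lookup : ∀ {n} {x : Fin n} {p} → x ∈ p → lookup p x ≡ true
∈⇒lookup = VP.[]=⇒lookup

lookup⇒∈ : ∀ {n} {x : Fin n} {p} → lookup p x ≡ true → x ∈ p
lookup⇒∈ {x = x} {p} = VP.lookup⇒[]= x p

∉⇒lookup : ∀ {n} {x : Fin n} {p} → x ∉ p → lookup p x ≡ false
∉⇒lookup {x = x} {p} h with lookup p x in eq
... | true = ⊥-elim (h (lookup⇒∈ eq))
... | false = refl

lookup⇒∉ : ∀ {n} {x : Fin n} {p} → lookup p x ≡ false → x ∉ p
lookup⇒∉ e m = true≢false (trans (sym (∈⇒lookup m)) e)


∣∣≡∣tabulate-lookup∣ : ∀ {n} (p : Subset n) → ∣ p ∣ ≡ ∣ tabulate (lookup p) ∣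
∣∣≡∣tabulate-lookup∣ p = cong ∣_∣ (sym (VP.tabulate∘lookup p))

∣tabulate∣-drop-one : ∀ {n} (f g : Fin n → Bool) (x : Fin n) → (∀ i → i ≢ x → f i ≡ g i)
      → f x ≡ true → g x ≡ false → ∣ tabulate f ∣ ≡ suc ∣ tabulate g ∣
∣tabulate∣-drop-one {suc n} f g zero h fx gx rewrite fx | gx
  = cong suc (cong ∣_∣ (VP.tabulate-cong (λ i → h (suc i) (λ ()))))
∣tabulate∣-drop-one {suc n} f g (suc x) h fx gx rewrite h zero (λ ()) with g zero
... | true = cong suc (∣tabulate∣-drop-one (f ∘ suc) (g ∘ suc) x (λ i ne → h (suc i) (λ e → ne (FP.suc-injective e))) fx gx)
... | false = ∣tabulate∣-drop-one (f ∘ suc) (g ∘ suc) x (λ i ne → h (suc i) (λ e → ne (FP.suc-injective e))) fx gx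

∣tabulate∣-cong : ∀ {n} (f g : Fin n → Bool) → (∀ i → f i ≡ g i) → ∣ tabulate f ∣ ≡ ∣ tabulate g ∣
∣tabulate∣-cong f g h = cong ∣_∣ (VP.tabulate-cong h)

∣∣-drop-one : ∀ {n} (p q : Subset n) (x : Fin n) → (∀ i → i ≢ x → lookup p i ≡ lookup q i)
        → lookup p x ≡ true → lookup q x ≡ false → ∣ p ∣ ≡ suc ∣ q ∣
∣∣-drop-one p q x h a b = trans (∣∣≡∣tabulate-lookup∣ p)
  (trans (∣tabulate∣-drop-one (lookup p) (lookup q) x h a b) (cong suc (sym (∣∣≡∣tabulate-lookup∣ q))))

lookup-insert-self : ∀ {n} (A : Subset n) x → lookup (insert A x) x ≡ true
lookup-insert-self A x rewrite lookup-∪ A ⁅ x ⁆ x | lookup-⁅x⁆-x x = BP.∨-zeroʳ _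

lookup-insert-other : ∀ {n} (A : Subset n) x i → i ≢ x → lookup (insert A x) i ≡ lookup A i
lookup-insert-other A x i ne rewrite lookup-∪ A ⁅ x ⁆ i | lookup-⁅x⁆-≢ x i ne = BP.∨-identityʳ _

lookup-remove-self : ∀ {n} (A : Subset n) x → lookup (remove A x) x ≡ false
lookup-remove-self A x rewrite lookup-─ A ⁅ x ⁆ x | lookup-⁅x⁆-x x = BP.∧-zeroʳ _

lookup-remove-other : ∀ {n} (A : Subset n) x i → i ≢ x → lookup (remove A x) i ≡ lookup A i
lookup-remove-other A x i ne rewrite lookup-─ A ⁅ x ⁆ i | lookup-⁅x⁆-≢ x i ne = BP.∧-identityʳ _

∣insert∣ : ∀ {n} (A : Subset n) x → lookup A x ≡ false → ∣ insert A x ∣ ≡ suc ∣ A ∣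
∣insert∣ A x e = ∣∣-drop-one (insert A x) A x (lookup-insert-other A x) (lookup-insert-self A x) e

∣∣≡suc∣remove∣ : ∀ {n} (A : Subset n) x → lookup A x ≡ true → ∣ A ∣ ≡ suc ∣ remove A x ∣
∣∣≡suc∣remove∣ A x e = ∣∣-drop-one A (remove A x) x (λ i ne → sym (lookup-remove-other A x i ne)) e (lookup-remove-self A x)


remove-insert : ∀ {n} (B : Subset n) x → lookup B x ≡ false → remove (insert B x) x ≡ B
remove-insert B x bx = subset-ext _ _ pt where
  pt : ∀ i → lookup (remove (insert B x) x) i ≡ lookup B i
  pt i with i ≟ x
  ... | yes refl rewrite lookup-remove-self (insert B i) i = sym bx
  ... | no ne rewrite lookup-remove-other (insert B x) x i ne = lookup-insert-other B x i ne

insert-remove : ∀ {n} (B : Subset n) u → lookup B u ≡ true → insert (remove B u) u ≡ B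
insert-remove B u bu = subset-ext _ _ pt where
  pt : ∀ i → lookup (insert (remove B u) u) i ≡ lookup B i
  pt i with i ≟ u
  ... | yes refl rewrite lookup-insert-self (remove B i) i = sym bu
  ... | no ne rewrite lookup-insert-other (remove B u) u i ne = lookup-remove-other B u i ne

remove-insert-comm : ∀ {n} (B : Subset n) x u → x ≢ u → remove (insert B x) u ≡ insert (remove B u) x
remove-insert-comm B x u ne = subset-ext _ _ pt where
  pt : ∀ i → lookup (remove (insert B x) u) i ≡ lookup (insert (remove B u) x) i
  pt i with i ≟ u | i ≟ x
  ... | yes refl | yes refl = ⊥-elim (ne refl)
  ... | yes refl | no n2 rewrite lookup-remove-self (insert B x) i | lookup-insert-other (remove B i) x i n2 | lookup-remove-self B i = refl
  ... | no n1 | yes refl rewrite lookup-remove-other (insert B i) u i n1 | lookup-insert-self B i | lookup-insert-self (remove B u) i = refl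
  ... | no n1 | no n2 rewrite lookup-remove-other (insert B x) u i n1 | lookup-insert-other B x i n2
                            | lookup-insert-other (remove B u) x i n2 | lookup-remove-other B u i n1 = refl

insert-comm : ∀ {n} (B : Subset n) x y → insert (insert B x) y ≡ insert (insert B y) x
insert-comm B x y =
  trans (SP.∪-assoc B ⁅ x ⁆ ⁅ y ⁆) (trans (cong (B ∪_) (SP.∪-comm ⁅ x ⁆ ⁅ y ⁆)) (sym (SP.∪-assoc B ⁅ y ⁆ ⁅ x ⁆)))

∈-insert⁻ : ∀ {n} {A : Subset n} {x i} → i ∈ insert A x → i ∈ A ⊎ i ≡ x
∈-insert⁻ {_} {A} {x} m with SP.x∈p∪q⁻ A ⁅ x ⁆ m
... | inj₁ a = inj₁ a
... | inj₂ b = inj₂ (SP.x∈⁅y⁆⇒x≡y x b)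

∈-insert⁺ : ∀ {n} {A : Subset n} {x i} → i ∈ A → i ∈ insert A x
∈-insert⁺ m = SP.x∈p∪q⁺ (inj₁ m)

∈-insert-self : ∀ {n} {A : Subset n} {x} → x ∈ insert A x
∈-insert-self {x = x} = SP.x∈p∪q⁺ (inj₂ (SP.x∈⁅x⁆ x))

∈-insert-≢ : ∀ {n} {A : Subset n} {x i} → i ∈ insert A x → i ≢ x → i ∈ A
∈-insert-≢ m ne with ∈-insert⁻ m
... | inj₁ a = a
... | inj₂ e = ⊥-elim (ne e)

∈-remove⁻ : ∀ {n} {A : Subset n} {x i} → i ∈ remove A x → i ∈ A × i ≢ x
∈-remove⁻ {_} {A} {x} {i} m with i ≟ x
... | yes refl with trans (sym (∈⇒lookup m)) (lookup-remove-self A x)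
...   | ()
∈-remove⁻ {_} {A} {x} {i} m | no ne = lookup⇒∈ (trans (sym (lookup-remove-other A x i ne)) (∈⇒lookup m)) , ne

∈-remove⁺ : ∀ {n} {A : Subset n} {x i} → i ∈ A → i ≢ x → i ∈ remove A x
∈-remove⁺ {_} {A} {x} {i} m ne = lookup⇒∈ (trans (lookup-remove-other A x i ne) (∈⇒lookup m))

⊆-∣≥∣⇒⊇ : ∀ {n} {A C : Subset n} → A ⊆ C → ∣ C ∣ ≤ ∣ A ∣ → C ⊆ A
⊆-∣≥∣⇒⊇ {_} {A} {C} sub le {i} iC with i ∈? A
... | yes iA = iA
... | no niA = ⊥-elim (NP.<-irrefl refl (NP.<-≤-trans (SP.p⊂q⇒∣p∣<∣q∣ (sub , i , iC , niA)) le))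

∣∣>0⇒nonempty : ∀ {n} (A : Subset n) → 0 < ∣ A ∣ → S.Nonempty A
∣∣>0⇒nonempty {n} A lt with SP.nonempty? A
... | yes p = p
... | no ¬p = ⊥-elim (NP.<-irrefl (sym (trans (cong ∣_∣ (SP.Empty-unique ¬p)) (SP.∣⊥∣≡0 n))) lt)

∣insert∣≤ : ∀ {n} (A : Subset n) x → ∣ insert A x ∣ ≤ suc ∣ A ∣
∣insert∣≤ A x with lookup A x in e
... | false = NP.≤-reflexive (∣insert∣ A x e)
... | true = subst (λ Z → ∣ Z ∣ ≤ suc ∣ A ∣) (sym (subset-ext (insert A x) A (pt e))) (NP.n≤1+n _)
  where pt : lookup A x ≡ true → ∀ i → lookup (insert A x) i ≡ lookup A i
        pt e i with i ≟ x
        ... | yes refl = trans (lookup-insert-self A i) (sym e)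
        ... | no ne = lookup-insert-other A x i ne


sumFin-cong : ∀ {n} (f g : Fin n → ℤ) → (∀ x → f x ≡ g x) → sumFin f ≡ sumFin g
sumFin-cong {zero} f g h = refl
sumFin-cong {suc n} f g h = cong₂ _+_ (h zero) (sumFin-cong (f ∘ suc) (g ∘ suc) (h ∘ suc))

sumFin-zero : ∀ {n} (f : Fin n → ℤ) → (∀ x → f x ≡ 0ℤ) → sumFin f ≡ 0ℤ
sumFin-zero {zero} f h = refl
sumFin-zero {suc n} f h rewrite h zero | sumFin-zero (f ∘ suc) (h ∘ suc) = refl

sumFin-single : ∀ {n} (f : Fin n → ℤ) (x0 : Fin n) → (∀ x → x ≢ x0 → f x ≡ 0ℤ) → sumFin f ≡ f x0
sumFin-single {suc n} f zero h rewrite sumFin-zero (f ∘ suc) (λ x → h (suc x) (λ ())) = ZP.+-identityʳ _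
sumFin-single {suc n} f (suc x0) h rewrite h zero (λ ()) =
  trans (ZP.+-identityˡ _) (sumFin-single (f ∘ suc) x0 (λ x ne → h (suc x) (λ e → ne (FP.suc-injective e))))

sumFin-+ : ∀ {n} (f g : Fin n → ℤ) → sumFin (λ x → f x + g x) ≡ sumFin f + sumFin g
sumFin-+ {zero} f g = refl
sumFin-+ {suc n} f g rewrite sumFin-+ (f ∘ suc) (g ∘ suc) = by-ring (f zero) (g zero) (sumFin (f ∘ suc)) (sumFin (g ∘ suc))
  where by-ring : ∀ a b c d → a + b + (c + d) ≡ a + c + (b + d)
        by-ring = solve-∀

sumFin-* : ∀ {n} (a : ℤ) (f : Fin n → ℤ) → sumFin (λ x → a * f x) ≡ a * sumFin f
sumFin-* {zero} a f = sym (ZP.*-zeroʳ a)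
sumFin-* {suc n} a f rewrite sumFin-* a (f ∘ suc) = sym (ZP.*-distribˡ-+ a (f zero) (sumFin (f ∘ suc)))

sumFin-swap : ∀ {n m} (F : Fin n → Fin m → ℤ) →
  sumFin (λ x → sumFin (λ y → F x y)) ≡ sumFin (λ y → sumFin (λ x → F x y))
sumFin-swap {zero} {m} F = sym (sumFin-zero {m} _ (λ _ → refl))
sumFin-swap {suc n} F rewrite sumFin-swap (λ x y → F (suc x) y) =
  sym (sumFin-+ (λ y → F zero y) (λ y → sumFin (λ x → F (suc x) y)))

sumFin-pair : ∀ {n} (f : Fin n → ℤ) y1 y2 → y1 ≢ y2 → (∀ y → y ≢ y1 → y ≢ y2 → f y ≡ 0ℤ) → sumFin f ≡ f y1 + f y2
sumFin-pair {n} f y1 y2 ne h = trans (sumFin-cong f (λ y → g1 y + g2 y) split) (trans (sumFin-+ g1 g2)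
    (cong₂ _+_ (trans (sumFin-single g1 y1 z1) (g1at)) (trans (sumFin-single g2 y2 z2) g2at)))
  where
  g1 : Fin n → ℤ
  g1 y = if does (y ≟ y1) then f y else 0ℤ
  g2 : Fin n → ℤ
  g2 y = if does (y ≟ y1) then 0ℤ else f y
  split : ∀ y → f y ≡ g1 y + g2 y
  split y with y ≟ y1
  ... | yes _ = sym (ZP.+-identityʳ (f y))
  ... | no _ = sym (ZP.+-identityˡ (f y))
  z1 : ∀ y → y ≢ y1 → g1 y ≡ 0ℤ
  z1 y ne1 with y ≟ y1
  ... | yes e = ⊥-elim (ne1 e)
  ... | no _ = refl
  g1at : g1 y1 ≡ f y1
  g1at with y1 ≟ y1
  ... | yes _ = refl
  ... | no n1 = ⊥-elim (n1 refl)
  z2 : ∀ y → y ≢ y2 → g2 y ≡ 0ℤ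
  z2 y ne2 with y ≟ y1
  ... | yes _ = refl
  ... | no ne1 = h y ne1 ne2
  g2at : g2 y2 ≡ f y2
  g2at with y2 ≟ y1
  ... | yes e = ⊥-elim (ne (sym e))
  ... | no _ = refl


sgn*sgn≡1 : ∀ k → sgn k * sgn k ≡ 1ℤ
sgn*sgn≡1 zero = refl
sgn*sgn≡1 (suc k) = trans (by-ring (sgn k)) (sgn*sgn≡1 k)
  where by-ring : ∀ s → (- s) * (- s) ≡ s * s
        by-ring = solve-∀

sgn-involutive : ∀ k c → sgn k * (sgn k * c) ≡ c
sgn-involutive k c = trans (sym (ZP.*-assoc (sgn k) (sgn k) c)) (trans (cong (_* c) (sgn*sgn≡1 k)) (ZP.*-identityˡ c))

ltᵇ : ∀ {n} → Fin n → Fin n → Bool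
ltᵇ x y = toℕ x <ᵇ toℕ y

ltᵇ-irrefl : ∀ {n} (x : Fin n) → ltᵇ x x ≡ false
ltᵇ-irrefl x = go (toℕ x) where
  go : ∀ m → (m <ᵇ m) ≡ false
  go zero = refl
  go (suc m) = go m

ltᵇ-connex : ∀ {n} (x u : Fin n) → x ≢ u →
  (ltᵇ x u ≡ true × ltᵇ u x ≡ false) ⊎ (ltᵇ x u ≡ false × ltᵇ u x ≡ true)
ltᵇ-connex zero zero ne = ⊥-elim (ne refl)
ltᵇ-connex zero (suc u) ne = inj₁ (refl , refl)
ltᵇ-connex (suc x) zero ne = inj₂ (refl , refl)
ltᵇ-connex (suc x) (suc u) ne = ltᵇ-connex x u (λ e → ne (cong suc e))

sucIf : Bool → ℕ → ℕ
sucIf true k = suc k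
sucIf false k = k


belowᵇ : ∀ {n} → Fin n → Subset n → Fin n → Bool
belowᵇ x B y = if lookup B y then ltᵇ y x else false

below-cong : ∀ {n} (y : Fin n) (B C : Subset n) → (∀ i → i ≢ y → lookup B i ≡ lookup C i) → below y B ≡ below y C
below-cong y B C h = ∣tabulate∣-cong (belowᵇ y B) (belowᵇ y C) pt where
  pt : ∀ i → belowᵇ y B i ≡ belowᵇ y C i
  pt i with i ≟ y
  ... | yes refl rewrite ltᵇ-irrefl i with lookup B i | lookup C i
  ... | true | true = refl
  ... | true | false = refl
  ... | false | true = refl
  ... | false | false = refl
  pt i | no ne rewrite h i ne = refl

below-insert : ∀ {n} (y x : Fin n) (B : Subset n) → lookup B x ≡ false →
  below y (insert B x) ≡ sucIf (ltᵇ x y) (below y B)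
below-insert y x B bx with ltᵇ x y in exy
... | true = ∣tabulate∣-drop-one (belowᵇ y (insert B x)) (belowᵇ y B) x pt f1 f2 where
  pt : ∀ i → i ≢ x → belowᵇ y (insert B x) i ≡ belowᵇ y B i
  pt i ne rewrite lookup-insert-other B x i ne = refl
  f1 : belowᵇ y (insert B x) x ≡ true
  f1 rewrite lookup-insert-self B x = exy
  f2 : belowᵇ y B x ≡ false
  f2 rewrite bx = refl
... | false = ∣tabulate∣-cong (belowᵇ y (insert B x)) (belowᵇ y B) pt where
  pt : ∀ i → belowᵇ y (insert B x) i ≡ belowᵇ y B i
  pt i with i ≟ x
  ... | yes refl rewrite lookup-insert-self B i | bx = exy
  ... | no ne rewrite lookup-insert-other B x i ne = refl

-- Exactly one of x, u precedes the other, so exactly one of the two counts is bumped.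
sgn-exchange : ∀ {n} (x u : Fin n) (a b : ℕ) → x ≢ u →
  sgn (sucIf (ltᵇ u x) a) * sgn (sucIf (ltᵇ x u) b) + sgn b * sgn a ≡ 0ℤ
sgn-exchange x u a b ne with ltᵇ-connex x u ne
... | inj₁ (p , q) rewrite p | q = by-ring (sgn a) (sgn b)
  where by-ring : ∀ s t → s * (- t) + t * s ≡ 0ℤ
        by-ring = solve-∀
... | inj₂ (p , q) rewrite p | q = by-ring (sgn a) (sgn b)
  where by-ring : ∀ s t → (- s) * t + t * s ≡ 0ℤ
        by-ring = solve-∀

sgn-exchange′ : ∀ {n} (x y : Fin n) (a b : ℕ) → x ≢ y →
  sgn a * sgn (sucIf (ltᵇ x y) b) + sgn b * sgn (sucIf (ltᵇ y x) a) ≡ 0ℤ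
sgn-exchange′ x y a b ne with ltᵇ-connex x y ne
... | inj₁ (p , q) rewrite p | q = by-ring (sgn a) (sgn b)
  where by-ring : ∀ s t → s * (- t) + t * s ≡ 0ℤ
        by-ring = solve-∀
... | inj₂ (p , q) rewrite p | q = by-ring (sgn a) (sgn b)
  where by-ring : ∀ s t → s * t + t * (- s) ≡ 0ℤ
        by-ring = solve-∀


-- The simplicial boundary and the cone construction

module _ {n : ℕ} where
  ∂-term : (Subset n → ℤ) → Subset n → Fin n → ℤ
  ∂-term c B x = if lookup B x then 0ℤ else sgn (below x B) * c (insert B x)

  ∂-term-∈ : ∀ c B x → lookup B x ≡ true → ∂-term c B x ≡ 0ℤ
  ∂-term-∈ c B x e rewrite e = refl

  ∂-term-∉ : ∀ c B x → lookup B x ≡ false → ∂-term c B x ≡ sgn (below x B) * c (insert B x)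
  ∂-term-∉ c B x e rewrite e = refl

  cone : Fin n → (Subset n → ℤ) → Subset n → ℤ
  cone u c A = if lookup A u then sgn (below u A) * c (remove A u) else 0ℤ

  cone-∈ : ∀ u c A → lookup A u ≡ true → cone u c A ≡ sgn (below u A) * c (remove A u)
  cone-∈ u c A e rewrite e = refl

  cone-∉ : ∀ u c A → lookup A u ≡ false → cone u c A ≡ 0ℤ
  cone-∉ u c A e rewrite e = refl

  ∂-cone+cone-∂ : ∀ u c B → ∂ (cone u c) B + cone u (∂ c) B ≡ c B
  ∂-cone+cone-∂ u c B with lookup B u in eb
  ... | false rewrite ZP.+-identityʳ (∂ (cone u c) B) =
    trans (sumFin-single (∂-term (cone u c) B) u pt) atu
    where
    pt : ∀ x → x ≢ u → ∂-term (cone u c) B x ≡ 0ℤ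
    pt x ne with lookup B x in ebx
    ... | true = refl
    ... | false rewrite cone-∉ u c (insert B x) (trans (lookup-insert-other B x u (λ e → ne (sym e))) eb) = ZP.*-zeroʳ (sgn (below x B))
    atu : ∂-term (cone u c) B u ≡ c B
    atu rewrite ∂-term-∉ (cone u c) B u eb | cone-∈ u c (insert B u) (lookup-insert-self B u)
              | below-insert u u B eb | ltᵇ-irrefl u | remove-insert B u eb = sgn-involutive (below u B) (c B)
  ... | true rewrite sym (sumFin-* (sgn (below u B)) (∂-term c (remove B u)))
         | sym (sumFin-+ (∂-term (cone u c) B) (λ x → sgn (below u B) * ∂-term c (remove B u) x)) =
    trans (sumFin-single _ u pt) atu
    where
    pt : ∀ x → x ≢ u → ∂-term (cone u c) B x + sgn (below u B) * ∂-term c (remove B u) x ≡ 0ℤ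
    pt x ne with lookup B x in ebx
    ... | true rewrite ∂-term-∈ c (remove B u) x (trans (lookup-remove-other B u x ne) ebx) | ZP.*-zeroʳ (sgn (below u B)) = refl
    ... | false rewrite cone-∈ u c (insert B x) (trans (lookup-insert-other B x u (λ e → ne (sym e))) eb)
                      | ∂-term-∉ c (remove B u) x (trans (lookup-remove-other B u x ne) ebx)
                      | remove-insert-comm B x u ne
                      | below-insert u x B ebx
                      | sym (cong (below x) (insert-remove B u eb))
                      | below-insert x u (remove B u) (lookup-remove-self B u) =
      trans (by-ring (sgn (sucIf (ltᵇ u x) (below x (remove B u)))) (sgn (sucIf (ltᵇ x u) (below u B)))
                 (sgn (below u B)) (sgn (below x (remove B u))) (c (insert (remove B u) x)))
            (trans (cong (_* c (insert (remove B u) x)) (sgn-exchange x u (below x (remove B u)) (below u B) ne)) refl)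
      where by-ring : ∀ p q r t C → p * (q * C) + r * (t * C) ≡ (p * q + r * t) * C
            by-ring = solve-∀
    atu : ∂-term (cone u c) B u + sgn (below u B) * ∂-term c (remove B u) u ≡ c B
    atu rewrite ∂-term-∈ (cone u c) B u eb | ∂-term-∉ c (remove B u) u (lookup-remove-self B u)
              | below-cong u (remove B u) B (λ i ne → lookup-remove-other B u i ne)
              | insert-remove B u eb = trans (ZP.+-identityˡ _) (sgn-involutive (below u B) (c B))

  double≡0⇒≡0 : ∀ a → a + a ≡ 0ℤ → a ≡ 0ℤ
  double≡0⇒≡0 a e = ZP.*-cancelˡ-≡ (+ 2) a 0ℤ (trans (by-ring a) e)
    where by-ring : ∀ a → + 2 * a ≡ a + a
          by-ring = solve-∀

  -- Writing ∂ (∂ c) B as a double sum S over the two added vertices, swapping them gives S = − S.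
  ∂∂≡0 : ∀ c B → ∂ (∂ c) B ≡ 0ℤ
  ∂∂≡0 c B = trans e1 (double≡0⇒≡0 S S+S≡0)
    where
    F : Fin n → Fin n → ℤ
    F x y = if lookup B x then 0ℤ else sgn (below x B) * ∂-term c (insert B x) y
    S = sumFin (λ x → sumFin (F x))
    e1 : ∂ (∂ c) B ≡ S
    e1 = sumFin-cong _ _ pt where
      pt : ∀ x → ∂-term (∂ c) B x ≡ sumFin (F x)
      pt x with lookup B x
      ... | true = sym (sumFin-zero {n} (λ _ → 0ℤ) (λ _ → refl))
      ... | false = sym (sumFin-* (sgn (below x B)) (∂-term c (insert B x)))
    F-in : ∀ x y → lookup B x ≡ true → F x y ≡ 0ℤ
    F-in x y e rewrite e = refl
    F-out : ∀ x y → lookup B x ≡ false → F x y ≡ sgn (below x B) * ∂-term c (insert B x) y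
    F-out x y e rewrite e = refl
    dif : ∀ x y → lookup B x ≡ true → lookup B y ≡ false → x ≢ y
    dif x .x ex ey refl = true≢false (trans (sym ex) ey)
    half : ∀ x y → lookup B x ≡ true → lookup B y ≡ false → F x y + F y x ≡ 0ℤ
    half x y ex ey rewrite F-in x y ex | F-out y x ey
      | ∂-term-∈ c (insert B y) x (trans (lookup-insert-other B y x (dif x y ex ey)) ex) =
      trans (ZP.+-identityˡ _) (ZP.*-zeroʳ (sgn (below y B)))
    anti : ∀ x y → F x y + F y x ≡ 0ℤ
    anti x y = go (lookup B x) (lookup B y) refl refl where
     go : ∀ bx by → lookup B x ≡ bx → lookup B y ≡ by → F x y + F y x ≡ 0ℤ
     go true true ex ey rewrite F-in x y ex | F-in y x ey = refl
     go true false ex ey = half x y ex ey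
     go false true ex ey = trans (ZP.+-comm (F x y) (F y x)) (half y x ey ex)
     go false false ex ey with x ≟ y
     ... | yes refl rewrite F-out x x ex | ∂-term-∈ c (insert B x) x (lookup-insert-self B x) =
       cong₂ _+_ (ZP.*-zeroʳ (sgn (below x B))) (ZP.*-zeroʳ (sgn (below x B)))
     ... | no ne rewrite F-out x y ex | F-out y x ey
             | ∂-term-∉ c (insert B x) y (trans (lookup-insert-other B x y (λ e → ne (sym e))) ey)
             | ∂-term-∉ c (insert B y) x (trans (lookup-insert-other B y x ne) ex)
             | below-insert y x B ex | below-insert x y B ey | insert-comm B x y =
      trans (by-ring (sgn (below x B)) (sgn (sucIf (ltᵇ x y) (below y B))) (sgn (below y B)) (sgn (sucIf (ltᵇ y x) (below x B)))
                     (c (insert (insert B y) x)))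
            (cong (_* c (insert (insert B y) x)) (sgn-exchange′ x y (below x B) (below y B) ne))
      where by-ring : ∀ p q r t C → p * (q * C) + r * (t * C) ≡ (p * q + r * t) * C
            by-ring = solve-∀
    S+S≡0 : S + S ≡ 0ℤ
    S+S≡0 = begin
      S + S                                              ≡⟨ cong (_+_ S) (sumFin-swap F) ⟩
      S + sumFin (λ y → sumFin (λ x → F x y))            ≡⟨ sym (sumFin-+ (λ x → sumFin (F x)) (λ y → sumFin (λ x → F x y))) ⟩
      sumFin (λ x → sumFin (F x) + sumFin (λ y → F y x)) ≡⟨ sumFin-cong _ _ (λ x → sym (sumFin-+ (F x) (λ y → F y x))) ⟩
      sumFin (λ x → sumFin (λ y → F x y + F y x))        ≡⟨ sumFin-zero _ (λ x → sumFin-zero _ (anti x)) ⟩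
      0ℤ                                                 ∎
      where open ≡-Reasoning

  ∂-+ : ∀ (f g : Subset n → ℤ) B → ∂ (λ A → f A + g A) B ≡ ∂ f B + ∂ g B
  ∂-+ f g B = trans (sumFin-cong _ (λ x → ∂-term f B x + ∂-term g B x) pt) (sumFin-+ (∂-term f B) (∂-term g B))
    where pt : ∀ x → ∂-term (λ A → f A + g A) B x ≡ ∂-term f B x + ∂-term g B x
          pt x with lookup B x
          ... | true = refl
          ... | false = ZP.*-distribˡ-+ (sgn (below x B)) (f (insert B x)) (g (insert B x))

  ∂-neg : ∀ (f : Subset n → ℤ) B → ∂ (λ A → - f A) B ≡ - ∂ f B
  ∂-neg f B = trans (sumFin-cong _ (λ x → Z.-1ℤ * ∂-term f B x) pt) (trans (sumFin-* Z.-1ℤ (∂-term f B)) (ZP.-1*i≡-i (∂ f B)))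
    where pt : ∀ x → ∂-term (λ A → - f A) B x ≡ Z.-1ℤ * ∂-term f B x
          pt x with lookup B x
          ... | true = refl
          ... | false = by-ring (sgn (below x B)) (f (insert B x))
            where by-ring : ∀ s a → s * (- a) ≡ Z.-1ℤ * (s * a)
                  by-ring = solve-∀

  cone-zero : ∀ (u : Fin n) c A → (∀ B → c B ≡ 0ℤ) → cone u c A ≡ 0ℤ
  cone-zero u c A h with lookup A u
  ... | true = trans (cong (sgn (below u A) *_) (h (remove A u))) (ZP.*-zeroʳ (sgn (below u A)))
  ... | false = refl

  ∂-cone-cycle : ∀ u c B → (∀ A → ∂ c A ≡ 0ℤ) → ∂ (cone u c) B ≡ c B
  ∂-cone-cycle u c B h =
    trans (sym (ZP.+-identityʳ (∂ (cone u c) B))) (trans (cong (_+_ (∂ (cone u c) B)) (sym (cone-zero u (∂ c) B h))) (∂-cone+cone-∂ u c B))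

  ∂-vanishing : ∀ c B → (∀ x → lookup B x ≡ false → c (insert B x) ≡ 0ℤ) → ∂ c B ≡ 0ℤ
  ∂-vanishing c B h = sumFin-zero (∂-term c B) λ x → bool-cases (lookup B x) (∂-term-∈ c B x) λ x∉B →
    trans (∂-term-∉ c B x x∉B) (trans (cong (sgn (below x B) *_) (h x x∉B)) (ZP.*-zeroʳ (sgn (below x B))))

  ∂-single : ∀ c B a → lookup B a ≡ false → (∀ x → x ≢ a → lookup B x ≡ false → c (insert B x) ≡ 0ℤ) →
             ∂ c B ≡ sgn (below a B) * c (insert B a)
  ∂-single c B a a∉B h = trans (sumFin-single (∂-term c B) a others) (∂-term-∉ c B a a∉B)
    where others : ∀ x → x ≢ a → ∂-term c B x ≡ 0ℤ
          others x x≢a = bool-cases (lookup B x) (∂-term-∈ c B x) λ x∉B →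
            trans (∂-term-∉ c B x x∉B) (trans (cong (sgn (below x B) *_) (h x x≢a x∉B)) (ZP.*-zeroʳ (sgn (below x B))))


open RawMonad (¬¬-Monad {a = 0ℓ}) using (pure; _>>=_)

¬¬-decide-all : ∀ {n} (P : Fin n → Set) → DoubleNegation (∀ i → Dec (P i))
¬¬-decide-all {zero} P = pure (λ ())
¬¬-decide-all {suc n} P = do
  d₀ ← ¬¬-excluded-middle
  ds ← ¬¬-decide-all (P ∘ suc)
  pure λ { zero → d₀ ; (suc i) → ds i }


-- Walks, components and simplices of Ind_r(G)

module Walks {n : ℕ} (G : Graph n) where
  open Graph G using (adj; irrefl) renaming (sym to gsym)

  Adj-sym : ∀ {x y} → Adj G x y → Adj G y x
  Adj-sym {x} {y} a = trans (gsym y x) a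

  Adj⇒≢ : ∀ {x y} → Adj G x y → x ≢ y
  Adj⇒≢ {x} a refl = true≢false (trans (sym a) (irrefl x))

  ¬Adj⇒adj≡false : ∀ {x y} → ¬ Adj G x y → adj x y ≡ false
  ¬Adj⇒adj≡false {x} {y} ¬x~y with adj x y
  ... | true = ⊥-elim (¬x~y refl)
  ... | false = refl

  Adj⇒∣Nbhd∣>0 : ∀ {v u} → Adj G v u → 0 < ∣ Nbhd G v ∣
  Adj⇒∣Nbhd∣>0 {v} {u} v~u = NP.≤-trans (NP.≤-reflexive (sym (SP.∣⁅x⁆∣≡1 u))) (SP.p⊆q⇒∣p∣≤∣q∣ ⁅u⁆⊆N)
    where ⁅u⁆⊆N : ⁅ u ⁆ ⊆ Nbhd G v
          ⁅u⁆⊆N m rewrite SP.x∈⁅y⁆⇒x≡y u m = lookup⇒∈ (trans (VP.lookup∘tabulate (adj v) u) v~u)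

  walk-start : ∀ {S x y} → Walk G S x y → x ∈ S
  walk-start (here p) = p
  walk-start (step p _ _) = p

  walk-end : ∀ {S x y} → Walk G S x y → y ∈ S
  walk-end (here p) = p
  walk-end (step _ _ w) = walk-end w

  walk-mono : ∀ {A B : Subset n} → A ⊆ B → ∀ {x y} → Walk G A x y → Walk G B x y
  walk-mono h (here p) = here (h p)
  walk-mono h (step p a w) = step (h p) a (walk-mono h w)

  walk-++ : ∀ {A x y z} → Walk G A x y → Walk G A y z → Walk G A x z
  walk-++ (here p) w2 = w2
  walk-++ (step p a w) w2 = step p a (walk-++ w w2)

  walk-reverse : ∀ {A x y} → Walk G A x y → Walk G A y x
  walk-reverse (here p) = here p
  walk-reverse (step p a w) = walk-++ (walk-reverse w) (step (walk-start w) (Adj-sym a) (here p))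

  NoEdgesOut : Subset n → Subset n → Set
  NoEdgesOut A1 A = ∀ i j → i ∈ A1 → j ∈ A → j ∉ A1 → ¬ Adj G i j

  walk-confine : ∀ {A1 A} → NoEdgesOut A1 A → ∀ {x y} → Walk G A x y → x ∈ A1 → Walk G A1 x y
  walk-confine s (here p) x1 = here x1
  walk-confine {A1} s (step {x} {y'} p a w) x1 with y' ∈? A1
  ... | yes y1 = step x1 a (walk-confine s w y1)
  ... | no y1 = ⊥-elim (s x y' x1 (walk-start w) y1 a)

  module _ (r : ℕ) where
    Simplex : Subset n → Set
    Simplex A = IsSimplex G r A

    simplex-small : ∀ A → ∣ A ∣ ≤ r → Simplex A
    simplex-small A h x T xA c = NP.≤-trans (SP.p⊆q⇒∣p∣≤∣q∣ (λ yT → proj₁ (Equivalence.to (c _) yT))) h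

    component-restrict : ∀ {A1 A x T} → A1 ⊆ A → NoEdgesOut A1 A → x ∈ A1 →
      Component G A x T → Component G A1 x T
    component-restrict sub s x1 c y = mk⇔
      (λ yT → let (yA , w) = Equivalence.to (c y) yT ; w1 = walk-confine s w x1 in walk-end w1 , w1)
      (λ (y1 , w) → Equivalence.from (c y) (sub y1 , walk-mono sub w))

    component-extend : ∀ {A1 A x T} → A1 ⊆ A → NoEdgesOut A1 A → x ∈ A1 →
      Component G A1 x T → Component G A x T
    component-extend sub s x1 c y = mk⇔
      (λ yT → let (y1 , w) = Equivalence.to (c y) yT in sub y1 , walk-mono sub w)
      (λ (yA , w) → let w1 = walk-confine s w x1 in Equivalence.from (c y) (walk-end w1 , w1))

    simplex-∪ : ∀ A A1 A2 → (∀ {i} → i ∈ A → i ∈ A1 ⊎ i ∈ A2) → A1 ⊆ A → A2 ⊆ A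
      → (∀ i j → i ∈ A1 → j ∈ A2 → ¬ Adj G i j) → Simplex A1 → Simplex A2 → Simplex A
    simplex-∪ A A1 A2 cov s1 s2 sp k1 k2 x T xA c with cov xA
    ... | inj₁ x1 = k1 x T x1 (component-restrict s1 sep1 x1 c)
      where sep1 : NoEdgesOut A1 A
            sep1 i j i1 jA j1 with cov jA
            ... | inj₁ j1' = ⊥-elim (j1 j1')
            ... | inj₂ j2 = sp i j i1 j2
    ... | inj₂ x2 = k2 x T x2 (component-restrict s2 sep2 x2 c)
      where sep2 : NoEdgesOut A2 A
            sep2 i j i2 jA j2 a with cov jA
            ... | inj₁ j1 = sp j i j1 i2 (Adj-sym a)
            ... | inj₂ j2' = j2 j2'

    simplex-part : ∀ A A1 → A1 ⊆ A → NoEdgesOut A1 A → Simplex A → Simplex A1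
    simplex-part A A1 sub s k x T x1 c = k x T (sub x1) (component-extend sub s x1 c)

    -- Reachability is not decided here, so components exist only up to double negation; this is
    -- enough because every conclusion drawn from them (an inequality, an equation in ℤ) is stable.
    component-exists : ∀ A x → DoubleNegation (Σ (Subset n) (λ T → Component G A x T))
    component-exists A x = ¬¬-decide-all (λ y → Walk G A x y) >>= λ d →
      pure (tabulate (λ y → does (d y)) , λ y → mk⇔ (to' d y) (from' d y))
      where
      module _ (d : ∀ y → Dec (Walk G A x y)) where
        lt : ∀ y → lookup (tabulate (λ y → does (d y))) y ≡ does (d y)
        lt y = VP.lookup∘tabulate (λ y → does (d y)) y
        to' : ∀ y → y ∈ tabulate (λ y → does (d y)) → y ∈ A × Walk G A x y
        to' y m with d y | trans (sym (lt y)) (∈⇒lookup m)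
        ... | yes w | _ = walk-end w , w
        ... | no _ | ()
        from' : ∀ y → y ∈ A × Walk G A x y → y ∈ tabulate (λ y → does (d y))
        from' y (_ , w) with d y | lt y
        ... | yes _ | e = lookup⇒∈ e
        ... | no nw | _ = ⊥-elim (nw w)

    simplex-⊆ : ∀ A B → B ⊆ A → Simplex A → Simplex B
    simplex-⊆ A B sub k x T xB c = decidable-stable (_ N.≤? _) (component-exists A x >>= λ (T' , c') →
      pure (NP.≤-trans (SP.p⊆q⇒∣p∣≤∣q∣ (λ yT → let (yB , w) = Equivalence.to (c _) yT in
                                   Equivalence.from (c' _) (sub yB , walk-mono sub w)))
                         (k x T' (sub xB) c')))

    connected-large⇒¬simplex : ∀ A x → x ∈ A → Connected G A → r < ∣ A ∣ → ¬ Simplex A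
    connected-large⇒¬simplex A x xA cn lt k = NP.<-irrefl refl (NP.<-≤-trans lt (k x A xA (λ y → mk⇔ (λ yA → yA , cn x y xA yA) proj₁)))

  connected-insert : ∀ A x t → Connected G A → t ∈ A → Adj G x t → Connected G (insert A x)
  connected-insert A x t cn tA a = go
    where
    fromx : ∀ z → z ∈ insert A x → Walk G (insert A x) x z
    fromx z zm with ∈-insert⁻ zm
    ... | inj₁ zA = step ∈-insert-self a (walk-mono ∈-insert⁺ (cn t z tA zA))
    ... | inj₂ refl = here ∈-insert-self
    go : Connected G (insert A x)
    go y z ym zm with ∈-insert⁻ ym
    ... | inj₂ refl = fromx z zm
    ... | inj₁ yA with ∈-insert⁻ zm
    ...   | inj₁ zA = walk-mono ∈-insert⁺ (cn y z yA zA)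
    ...   | inj₂ refl = walk-reverse (fromx y ym)

  support-neighbour : ∀ S v y → Connected G (insert S v) → y ∈ S → v ∉ S → Σ (Fin n) (λ t → t ∈ insert S v × Adj G y t)
  support-neighbour S v y cn yS vS with cn y v (∈-insert⁺ yS) ∈-insert-self
  ... | here _ = ⊥-elim (vS yS)
  ... | step _ a w = _ , walk-start w , a

  walk-neighbour-of-end : ∀ {A a y} → Walk G A a y → a ≢ y → ¬ Adj G a y →
       Σ (Fin n) λ u0 → Σ (Fin n) λ p → u0 ∈ A × p ∈ A × Adj G u0 y × Adj G u0 p × p ≢ y
  walk-neighbour-of-end (here _) ne _ = ⊥-elim (ne refl)
  walk-neighbour-of-end {y = y} (step {a} {b} pa ab w) ne nay with b ≟ y
  ... | yes refl = ⊥-elim (nay ab)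
  ... | no bne with adj b y in eby
  ...   | true = b , a , walk-start w , pa , eby , Adj-sym ab , ne
  ...   | false = walk-neighbour-of-end w bne (λ e → true≢false (trans (sym e) eby))

  module ComponentFacts {A x R} (c : Component G A x R) where
    component⊆ : R ⊆ A
    component⊆ yR = proj₁ (Equivalence.to (c _) yR)
    component-root : x ∈ A → x ∈ R
    component-root xA = Equivalence.from (c x) (xA , here xA)
    component-closed : ∀ {t j} → t ∈ R → j ∈ A → Adj G t j → j ∈ R
    component-closed tR jA a = Equivalence.from (c _) (jA , walk-++ (proj₂ (Equivalence.to (c _) tR)) (step (component⊆ tR) a (here jA)))
    component-isolated : NoEdgesOut R A
    component-isolated i j iR jA jR a = jR (component-closed iR jA a)
    component-connected : x ∈ A → Connected G R
    component-connected xA y z yR zR = walk-++ (walk-reverse (wR yR)) (wR zR)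
      where wR : ∀ {y} → y ∈ R → Walk G R x y
            wR yR = walk-confine component-isolated (proj₂ (Equivalence.to (c _) yR)) (component-root xA)

  connected-cong : ∀ {A C} → A ⊆ C → C ⊆ A → Connected G A → Connected G C
  connected-cong f g cn y z yC zC = walk-mono f (cn y z (g yC) (g zC))


module Supports {n : ℕ} (G : Graph n) (v : Fin n) (H : ∀ u w → Adj G v u → InN₂ G v w → Adj G u w) where
  open Graph G using (adj)
  open Walks G

  walk-enters-N₂ : ∀ {S a y} → Walk G (insert S v) a y → (a ≡ v ⊎ Adj G v a) → adj v y ≡ false → y ≢ v →
       Σ (Fin n) λ q → q ∈ insert S v × InN₂ G v q
  walk-enters-N₂ (here _) (inj₁ refl) _ y≢v = ⊥-elim (y≢v refl)
  walk-enters-N₂ (here _) (inj₂ v~y) v≁y _ = ⊥-elim (true≢false (trans (sym v~y) v≁y))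
  walk-enters-N₂ {a = a} (step {y = b} _ a~b walk) a∈N[v] v≁y y≢v with b ≟ v
  ... | yes refl = walk-enters-N₂ walk (inj₁ refl) v≁y y≢v
  ... | no b≢v with adj v b in v~b
  ...   | true = walk-enters-N₂ walk (inj₂ v~b) v≁y y≢v
  ...   | false = b , walk-start walk , b≢v , v~b , a , v~a a∈N[v] , a~b
    where v~a : (a ≡ v ⊎ Adj G v a) → Adj G v a
          v~a (inj₂ v~a) = v~a
          v~a (inj₁ refl) = ⊥-elim (true≢false (trans (sym a~b) v~b))

  -- A walk from v to a vertex of S outside N(v) reaches some q ∈ S ∩ N₂(v); every x ∈ S
  -- then reaches q inside S by following its walk to v up to the last neighbour of v.
  large-support-connected : ∀ S → v ∉ S → Connected G (insert S v) → ∣ Nbhd G v ∣ < ∣ S ∣ → Connected G S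
  large-support-connected S v∉S conn N<S with FP.any? (λ w → w ∈? S ×-dec (adj v w B.≟ false))
  ... | no ∄w = ⊥-elim (NP.<⇒≱ N<S (SP.p⊆q⇒∣p∣≤∣q∣ S⊆N))
    where S⊆N : S ⊆ Nbhd G v
          S⊆N {i} i∈S with adj v i in e
          ... | true = lookup⇒∈ (trans (VP.lookup∘tabulate (adj v) i) e)
          ... | false = ⊥-elim (∄w (i , i∈S , e))
  ... | yes (w , w∈S , v≁w) = λ x y x∈S y∈S → walk-++ (to-q (conn x v (∈-insert⁺ x∈S) ∈-insert-self) x∈S)
                                                     (walk-reverse (to-q (conn y v (∈-insert⁺ y∈S) ∈-insert-self) y∈S))
    where
    found = walk-enters-N₂ (conn v w ∈-insert-self (∈-insert⁺ w∈S)) (inj₁ refl) v≁w (λ e → v∉S (subst (_∈ S) e w∈S))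
    q = proj₁ found
    q∈N₂ : InN₂ G v q
    q∈N₂ = proj₂ (proj₂ found)
    q∈S : q ∈ S
    q∈S = ∈-insert-≢ (proj₁ (proj₂ found)) (proj₁ q∈N₂)
    to-q : ∀ {x} → Walk G (insert S v) x v → x ∈ S → Walk G S x q
    to-q (here _) x∈S = ⊥-elim (v∉S x∈S)
    to-q {x} (step {y = y} _ x~y walk) x∈S with y ≟ v
    ... | yes refl = step x∈S (H x q (Adj-sym x~y) q∈N₂) (here q∈S)
    ... | no y≢v = step x∈S x~y (to-q walk (∈-insert-≢ (walk-start walk) y≢v))

  supports-connected : ∀ r → ∣ Nbhd G v ∣ < r → SuppConnected G r v
  supports-connected r N<r S (v∉S , ∣S∣≡r , conn) = large-support-connected S v∉S conn (subst (∣ Nbhd G v ∣ <_) (sym ∣S∣≡r) N<r)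


module Chains {n : ℕ} (G : Graph n) (r : ℕ) where
  open Walks G

  ∂-chain : ∀ k c → IsChain G r (suc k) c → IsChain G r k (∂ c)
  ∂-chain k c ch B nB = ∂-vanishing c B λ x x∉B → ch (insert B x) λ (s , ∣B∪x∣≡) →
    nB (simplex-⊆ r (insert B x) B ∈-insert⁺ s , NP.suc-injective (trans (sym (∣insert∣ B x x∉B)) ∣B∪x∣≡))

  cone-chain : ∀ k u c → IsChain G r k c →
    (∀ A → lookup A u ≡ true → Simplex r (remove A u) → ∣ remove A u ∣ ≡ k → c (remove A u) ≢ 0ℤ → Simplex r A) →
    IsChain G r (suc k) (cone u c)
  cone-chain k u c ch coneable A nA with lookup A u in e
  ... | false = refl
  ... | true = trans (cong (sgn (below u A) *_) cz) (ZP.*-zeroʳ (sgn (below u A)))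
    where cz : c (remove A u) ≡ 0ℤ
          cz = decidable-stable (_ Z.≟ _) λ ne → ne (ch (remove A u) λ (s , cd) →
                 nA (coneable A e s cd ne , trans (∣∣≡suc∣remove∣ A u e) (cong suc cd)))

  simplex-stable : ∀ {A} → DoubleNegation (Simplex r A) → Simplex r A
  simplex-stable d x T xA c = decidable-stable (_ N.≤? _) (λ nle → d (λ k → nle (k x T xA c)))

  homology-vanishes-below : Fin n → ∀ k → k < r → ReducedHomologyVanishes G r k
  homology-vanishes-below v k k<r z (chz , ∂z≡0) = cone v z , cone-chain k v z chz small , λ A → ∂-cone-cycle v z A ∂z≡0
    where small : ∀ A → lookup A v ≡ true → Simplex r (remove A v) → ∣ remove A v ∣ ≡ k → z (remove A v) ≢ 0ℤ → Simplex r A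
          small A e _ cd _ = simplex-small r A (subst (_≤ r) (sym (trans (∣∣≡suc∣remove∣ A v e) (cong suc cd))) k<r)

  -- z − ∂ e vanishes on the faces that cannot be coned from v, so it is the boundary of its cone.
  boundary-via-cone : ∀ (v : Fin n) k z → IsCycle G r k z → (e : Subset n → ℤ) → IsChain G r (suc k) e →
    (∀ B → v ∉ B → Simplex r B → ∣ B ∣ ≡ k → ¬ Simplex r (insert B v) → ∂ e B ≡ z B) → IsBoundary G r k z
  boundary-via-cone v k z (chz , ∂z≡0) e che ∂e≡z = e′ , chain , boundary
    where
    y : Subset n → ℤ
    y B = z B + - ∂ e B
    e′ : Subset n → ℤ
    e′ A = e A + cone v y A
    chy : IsChain G r k y
    chy B nB = cong₂ _+_ (chz B nB) (cong -_ (∂-chain k e che B nB))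
    ∂y≡0 : ∀ A → ∂ y A ≡ 0ℤ
    ∂y≡0 A = trans (∂-+ z (λ B → - ∂ e B) A) (cong₂ _+_ (∂z≡0 A) (trans (∂-neg (∂ e) A) (cong -_ (∂∂≡0 e A))))
    coneable : ∀ A → lookup A v ≡ true → Simplex r (remove A v) → ∣ remove A v ∣ ≡ k → y (remove A v) ≢ 0ℤ → Simplex r A
    coneable A ev s cd y≢0 = simplex-stable λ ¬s → y≢0 (trans
      (cong (λ t → z (remove A v) + - t)
        (∂e≡z (remove A v) (lookup⇒∉ (lookup-remove-self A v)) s cd (λ s′ → ¬s (subst (Simplex r) (insert-remove A v ev) s′))))
      (ZP.+-inverseʳ (z (remove A v))))
    chain : IsChain G r (suc k) e′
    chain A nA = cong₂ _+_ (che A nA) (cone-chain k v y chy coneable A nA)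
    boundary : ∀ B → ∂ e′ B ≡ z B
    boundary B = trans (∂-+ e (cone v y) B) (trans (cong (_+_ (∂ e B)) (∂-cone-cycle v y B ∂y≡0)) (cancel (∂ e B) (z B)))
      where cancel : ∀ a b → a + (b + - a) ≡ b
            cancel = solve-∀

  simplex-insert-isolated : ∀ {v} → 1 ≤ r → (∀ u → ¬ Adj G v u) → ∀ B → Simplex r B → Simplex r (insert B v)
  simplex-insert-isolated {v} r≥1 isolated B sB =
    simplex-∪ r (insert B v) B ⁅ v ⁆ split ∈-insert⁺ ⁅v⁆⊆ apart sB
              (simplex-small r ⁅ v ⁆ (subst (_≤ r) (sym (SP.∣⁅x⁆∣≡1 v)) r≥1))
    where
    split : ∀ {i} → i ∈ insert B v → i ∈ B ⊎ i ∈ ⁅ v ⁆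
    split m with ∈-insert⁻ m
    ... | inj₁ i∈B = inj₁ i∈B
    ... | inj₂ refl = inj₂ (SP.x∈⁅x⁆ v)
    ⁅v⁆⊆ : ⁅ v ⁆ ⊆ insert B v
    ⁅v⁆⊆ m = subst (_∈ insert B v) (sym (SP.x∈⁅y⁆⇒x≡y v m)) ∈-insert-self
    apart : ∀ i j → i ∈ B → j ∈ ⁅ v ⁆ → ¬ Adj G i j
    apart i j _ j∈⁅v⁆ i~j = isolated i (Adj-sym (subst (Adj G i) (SP.x∈⁅y⁆⇒x≡y v j∈⁅v⁆) i~j))

  isolated⇒homology-vanishes : ∀ v → 1 ≤ r → (∀ u → ¬ Adj G v u) → ∀ k → ReducedHomologyVanishes G r k
  isolated⇒homology-vanishes v r≥1 isolated k z cyc = boundary-via-cone v k z cyc (λ _ → 0ℤ) (λ _ _ → refl)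
    λ B _ sB _ ¬s → ⊥-elim (¬s (simplex-insert-isolated r≥1 isolated B sB))

  vanishes⇒torsionFree : ∀ k → ReducedHomologyVanishes G r k → ReducedHomologyTorsionFree G r k
  vanishes⇒torsionFree k vanishes _ z _ cyc _ = vanishes z cyc


module UnconeableFaces {n : ℕ} (G : Graph n) (r : ℕ) (v : Fin n) (H : ∀ u w → Adj G v u → InN₂ G v w → Adj G u w)
                       (small : ∣ Nbhd G v ∣ < r) where
  open Walks G
  open Supports G v H

  -- R is the component of v in G[B ∪ {v}]; it has more than r vertices because B is a simplex
  -- and B ∪ {v} is not.
  record VComponent (B R : Subset n) : Set where
    field
      v∈R : v ∈ R
      R⊆B∪v : R ⊆ insert B v
      R-connected : Connected G R
      R-v⊆B : remove R v ⊆ B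
      r≤∣R-v∣ : r ≤ ∣ remove R v ∣
      R-closed : ∀ {t j} → t ∈ R → j ∈ insert B v → Adj G t j → j ∈ R

  v-component : ∀ B → v ∉ B → Simplex r B → ¬ Simplex r (insert B v) → DoubleNegation (Σ (Subset n) (VComponent B))
  v-component B v∉B sB ¬s = do
    (R , c) ← component-exists r (insert B v) v
    pure (R , component R c)
    where
    component : ∀ R → Component G (insert B v) v R → VComponent B R
    component R c = record { v∈R = v∈R ; R⊆B∪v = component⊆ ; R-connected = component-connected ∈-insert-self
                           ; R-v⊆B = R-v⊆B ; r≤∣R-v∣ = r≤∣R-v∣ ; R-closed = component-closed }
      where
      open ComponentFacts c
      v∈R = component-root ∈-insert-self
      R-v⊆B : remove R v ⊆ B
      R-v⊆B m = let (i∈R , i≢v) = ∈-remove⁻ m in ∈-insert-≢ (component⊆ i∈R) i≢v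
      Rest = insert B v ─ R
      ∈Rest⁻ : ∀ {i} → i ∈ Rest → i ∈ insert B v × i ∉ R
      ∈Rest⁻ {i} m = let e = trans (sym (lookup-─ (insert B v) R i)) (∈⇒lookup m) in
        lookup⇒∈ (∧-trueˡ e) , lookup⇒∉ (not-true⁻ (∧-trueʳ {lookup (insert B v) i} e))
      ∈Rest⁺ : ∀ {i} → i ∈ insert B v → i ∉ R → i ∈ Rest
      ∈Rest⁺ {i} i∈ i∉R = lookup⇒∈ (trans (lookup-─ (insert B v) R i) (∧-true (∈⇒lookup i∈) (not-false⁺ (∉⇒lookup i∉R))))
      Rest⊆B : Rest ⊆ B
      Rest⊆B m = let (i∈ , i∉R) = ∈Rest⁻ m in ∈-insert-≢ i∈ (λ { refl → i∉R v∈R })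
      Rest-simplex : Simplex r Rest
      Rest-simplex = simplex-part r B Rest Rest⊆B apart sB
        where apart : NoEdgesOut Rest B
              apart i j i∈Rest j∈B j∉Rest i~j with j ∈? R
              ... | yes j∈R = proj₂ (∈Rest⁻ i∈Rest) (component-closed j∈R (proj₁ (∈Rest⁻ i∈Rest)) (Adj-sym i~j))
              ... | no j∉R = j∉Rest (∈Rest⁺ (∈-insert⁺ j∈B) j∉R)
      r<∣R∣ : r < ∣ R ∣
      r<∣R∣ = decidable-stable (r N.<? ∣ R ∣) λ r≮R → ¬s (simplex-∪ r (insert B v) R Rest split component⊆ (λ m → proj₁ (∈Rest⁻ m))
                 apart (simplex-small r R (NP.≮⇒≥ r≮R)) Rest-simplex)
        where
        split : ∀ {i} → i ∈ insert B v → i ∈ R ⊎ i ∈ Rest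
        split {i} m with i ∈? R
        ... | yes i∈R = inj₁ i∈R
        ... | no i∉R = inj₂ (∈Rest⁺ m i∉R)
        apart : ∀ i j → i ∈ R → j ∈ Rest → ¬ Adj G i j
        apart i j i∈R j∈Rest i~j = proj₂ (∈Rest⁻ j∈Rest) (component-closed i∈R (proj₁ (∈Rest⁻ j∈Rest)) i~j)
      r≤∣R-v∣ : r ≤ ∣ remove R v ∣
      r≤∣R-v∣ = NP.≤-pred (subst (r <_) (∣∣≡suc∣remove∣ R v (∈⇒lookup v∈R)) r<∣R∣)

  module _ {B R} (cm : VComponent B R) where
    open VComponent cm

    component-covers : B ⊆ remove R v → Connected G (insert B v)
    component-covers B⊆R-v = connected-cong R⊆B∪v B∪v⊆R R-connected
      where B∪v⊆R : insert B v ⊆ R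
            B∪v⊆R m with ∈-insert⁻ m
            ... | inj₁ i∈B = proj₁ (∈-remove⁻ (B⊆R-v i∈B))
            ... | inj₂ refl = v∈R

    -- Otherwise B ∪ {v} would be connected, and then so would B by the support lemma.
    component-size-suc-r : v ∉ B → Simplex r B → ∣ B ∣ ≡ suc r → ∣ remove R v ∣ ≡ r
    component-size-suc-r v∉B sB ∣B∣≡1+r = NP.≤-antisym (NP.≤-pred (NP.≤∧≢⇒< ≤1+r ≢1+r)) r≤∣R-v∣
      where
      ≤1+r : ∣ remove R v ∣ ≤ suc r
      ≤1+r = subst (∣ remove R v ∣ ≤_) ∣B∣≡1+r (SP.p⊆q⇒∣p∣≤∣q∣ R-v⊆B)
      ≢1+r : ∣ remove R v ∣ ≢ suc r
      ≢1+r e = connected-large⇒¬simplex r B x x∈B B-connected (subst (r <_) (sym ∣B∣≡1+r) (NP.n<1+n r)) sB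
        where
        B-connected : Connected G B
        B-connected = large-support-connected B v∉B (component-covers (⊆-∣≥∣⇒⊇ R-v⊆B (NP.≤-reflexive (trans ∣B∣≡1+r (sym e)))))
                        (subst (∣ Nbhd G v ∣ <_) (sym ∣B∣≡1+r) (NP.m≤n⇒m≤1+n small))
        x = proj₁ (∣∣>0⇒nonempty B (subst (0 <_) (sym ∣B∣≡1+r) (s≤s z≤n)))
        x∈B = proj₂ (∣∣>0⇒nonempty B (subst (0 <_) (sym ∣B∣≡1+r) (s≤s z≤n)))

  nonSimplex-r⇒connected : ∀ B → v ∉ B → Simplex r B → ¬ Simplex r (insert B v) → ∣ B ∣ ≡ r → DoubleNegation (Connected G (insert B v))
  nonSimplex-r⇒connected B v∉B sB ¬s ∣B∣≡r = do
    (R , cm) ← v-component B v∉B sB ¬s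
    pure (component-covers cm (⊆-∣≥∣⇒⊇ (VComponent.R-v⊆B cm) (subst (_≤ ∣ remove R v ∣) (sym ∣B∣≡r) (VComponent.r≤∣R-v∣ cm))))

  record SupportWithFar (B S : Subset n) (w : Fin n) : Set where
    field
      B≡S∪w : B ≡ insert S w
      w∉S : lookup S w ≡ false
      w≢v : w ≢ v
      v∉S : v ∉ S
      S∪v-connected : Connected G (insert S v)
      w-far : ∀ t → t ∈ insert S v → ¬ Adj G w t
      ∣S∣≡r : ∣ S ∣ ≡ r

  -- S is R − v and w is the vertex of B outside R.
  nonSimplex-suc-r⇒support : ∀ B → v ∉ B → Simplex r B → ¬ Simplex r (insert B v) → ∣ B ∣ ≡ suc r →
           DoubleNegation (Σ (Subset n) λ S → Σ (Fin n) λ w → SupportWithFar B S w)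
  nonSimplex-suc-r⇒support B v∉B sB ¬s ∣B∣≡1+r = do
    (R , cm) ← v-component B v∉B sB ¬s
    pure (build R cm)
    where
    build : ∀ R → VComponent B R → Σ (Subset n) λ S → Σ (Fin n) λ w → SupportWithFar B S w
    build R cm = S , w , record { B≡S∪w = sym (insert-remove B w (∈⇒lookup w∈B)) ; w∉S = lookup-remove-self B w
                                ; w≢v = λ e → v∉B (subst (_∈ B) e w∈B) ; v∉S = λ m → v∉B (proj₁ (∈-remove⁻ m))
                                ; S∪v-connected = connected-cong R⊆S∪v S∪v⊆R R-connected ; w-far = w-far ; ∣S∣≡r = ∣S∣≡r }
      where
      open VComponent cm
      ∣R-v∣≡r = component-size-suc-r cm v∉B sB ∣B∣≡1+r
      outside : Σ (Fin n) λ w → w ∈ B × w ∉ remove R v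
      outside with FP.any? (λ i → i ∈? B ×-dec ¬? (i ∈? remove R v))
      ... | yes found = found
      ... | no ∄ = ⊥-elim (NP.<-irrefl refl (NP.<-≤-trans (NP.n<1+n r) (NP.≤-trans (NP.≤-reflexive (sym ∣B∣≡1+r))
                      (NP.≤-trans (SP.p⊆q⇒∣p∣≤∣q∣ B⊆R-v) (NP.≤-reflexive ∣R-v∣≡r)))))
        where B⊆R-v : B ⊆ remove R v
              B⊆R-v {i} i∈B with i ∈? remove R v
              ... | yes i∈ = i∈
              ... | no i∉ = ⊥-elim (∄ (i , i∈B , i∉))
      w = proj₁ outside
      w∈B = proj₁ (proj₂ outside)
      w∉R-v = proj₂ (proj₂ outside)
      S = remove B w
      ∣S∣≡r : ∣ S ∣ ≡ r
      ∣S∣≡r = NP.suc-injective (trans (sym (∣∣≡suc∣remove∣ B w (∈⇒lookup w∈B))) ∣B∣≡1+r)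
      R-v⊆S : remove R v ⊆ S
      R-v⊆S m = ∈-remove⁺ (R-v⊆B m) (λ { refl → w∉R-v m })
      S⊆R-v : S ⊆ remove R v
      S⊆R-v = ⊆-∣≥∣⇒⊇ R-v⊆S (NP.≤-reflexive (trans ∣S∣≡r (sym ∣R-v∣≡r)))
      S∪v⊆R : insert S v ⊆ R
      S∪v⊆R m with ∈-insert⁻ m
      ... | inj₁ i∈S = proj₁ (∈-remove⁻ (S⊆R-v i∈S))
      ... | inj₂ refl = v∈R
      R⊆S∪v : R ⊆ insert S v
      R⊆S∪v {i} i∈R with i ≟ v
      ... | yes refl = ∈-insert-self
      ... | no i≢v = ∈-insert⁺ (R-v⊆S (∈-remove⁺ i∈R i≢v))
      w-far : ∀ t → t ∈ insert S v → ¬ Adj G w t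
      w-far t t∈ w~t = w∉R-v (∈-remove⁺ (R-closed (S∪v⊆R t∈) (∈-insert⁺ w∈B) (Adj-sym w~t)) (λ e → v∉B (subst (_∈ B) e w∈B)))


-- The core of a face B consists of the vertices of B with a neighbour in B ∪ {v}, the loose
-- vertices are the others, and a candidate apex of C is a vertex outside C ∪ {v} adjacent to
-- nothing in C ∪ {v}.  Ψ z puts ± z(B) on B ∪ {a}, where a is the least candidate apex of the
-- core of B, whenever B has at most one loose vertex.
module Transfer {n : ℕ} (G : Graph n) (v : Fin n) where
  open Graph G using (adj)

  isVᵇ : Fin n → Bool
  isVᵇ i = does (i ≟ v)

  inCoreᵇ : Subset n → Fin n → Bool
  inCoreᵇ B b = lookup B b ∧ anyᶠ (λ t → (lookup B t ∨ isVᵇ t) ∧ adj b t)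

  core : Subset n → Subset n
  core B = tabulate (inCoreᵇ B)

  loose : Subset n → Subset n
  loose B = tabulate (λ b → lookup B b ∧ not (inCoreᵇ B b))

  apexCandidateᵇ : Subset n → Fin n → Bool
  apexCandidateᵇ C u = not (lookup C u) ∧ (not (isVᵇ u) ∧ (not (adj v u) ∧ not (anyᶠ (λ t → lookup C t ∧ adj u t))))

  apexOf : Subset n → Maybe (Fin n)
  apexOf C = firstᶠ (apexCandidateᵇ C)

  apex : Subset n → Maybe (Fin n)
  apex B = apexOf (core B)

  goodᵇ : Subset n → Fin n → Bool
  goodᵇ B y = selectsᵇ (apex B) y ∧ (∣ loose B ∣ N.≤ᵇ 1)

  Ψ-term : (Subset n → ℤ) → Subset n → Fin n → ℤ
  Ψ-term z A y = if lookup A y ∧ goodᵇ (remove A y) y then sgn (below y (remove A y)) * z (remove A y) else 0ℤ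

  Ψ : (Subset n → ℤ) → Subset n → ℤ
  Ψ z A = sumFin (Ψ-term z A)

  lookup-core : ∀ B i → lookup (core B) i ≡ inCoreᵇ B i
  lookup-core B i = VP.lookup∘tabulate (inCoreᵇ B) i

  lookup-loose : ∀ B i → lookup (loose B) i ≡ (lookup B i ∧ not (inCoreᵇ B i))
  lookup-loose B i = VP.lookup∘tabulate _ i

  isVᵇ-v : isVᵇ v ≡ true
  isVᵇ-v = dec-true (v ≟ v) refl

  isVᵇ-true : ∀ {t} → isVᵇ t ≡ true → t ≡ v
  isVᵇ-true {t} e with t ≟ v
  ... | yes t≡v = t≡v

  isVᵇ-≡ : ∀ {t} → t ≡ v → isVᵇ t ≡ true
  isVᵇ-≡ refl = isVᵇ-v

  isVᵇ-≢ : ∀ {t} → t ≢ v → isVᵇ t ≡ false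
  isVᵇ-≢ {t} = dec-false (t ≟ v)

  module _ (C : Subset n) (u : Fin n) (candidate : apexCandidateᵇ C u ≡ true) where
    candidate-∉ : lookup C u ≡ false
    candidate-∉ = not-true⁻ (∧-trueˡ candidate)

    candidate-≁v : adj v u ≡ false
    candidate-≁v = not-true⁻ (∧-trueˡ (∧-trueʳ {not (isVᵇ u)} (∧-trueʳ {not (lookup C u)} candidate)))

    candidate-≁C : anyᶠ (λ t → lookup C t ∧ adj u t) ≡ false
    candidate-≁C = not-true⁻ (∧-trueʳ {not (adj v u)} (∧-trueʳ {not (isVᵇ u)} (∧-trueʳ {not (lookup C u)} candidate)))

  apex-candidate : ∀ B y → selectsᵇ (apex B) y ≡ true → apexCandidateᵇ (core B) y ≡ true
  apex-candidate B y e = firstᶠ-just _ y (selectsᵇ-sound (apex B) y e)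

  Ψ-term-∉ : ∀ z A y → lookup A y ≡ false → Ψ-term z A y ≡ 0ℤ
  Ψ-term-∉ z A y e rewrite e = refl

  Ψ-term-at : ∀ z A y B → remove A y ≡ B → lookup A y ≡ true →
              Ψ-term z A y ≡ (if goodᵇ B y then sgn (below y B) * z B else 0ℤ)
  Ψ-term-at z A y .(remove A y) refl e rewrite e = refl

  Ψ-term-not-apex : ∀ z A y → selectsᵇ (apex (remove A y)) y ≡ false → Ψ-term z A y ≡ 0ℤ
  Ψ-term-not-apex z A y e rewrite e | BP.∧-zeroʳ (lookup A y) = refl

  Ψ-term-off : ∀ z A y → (lookup A y ∧ goodᵇ (remove A y) y) ≡ false → Ψ-term z A y ≡ 0ℤ
  Ψ-term-off z A y e rewrite e = refl

  Ψ-term-on : ∀ z A y → (lookup A y ∧ goodᵇ (remove A y) y) ≡ true → Ψ-term z A y ≡ sgn (below y (remove A y)) * z (remove A y)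
  Ψ-term-on z A y e rewrite e = refl


module TransferChain {n : ℕ} (G : Graph n) (r : ℕ) (v : Fin n) where
  open Graph G using (adj)
  open Walks G
  open Transfer G v

  -- B ∪ {y} is the union of core B, which has no edges to the rest of B, and the at most two
  -- vertices of loose B ∪ {y}, which have no edges to core B.
  good-insert-simplex : 2 ≤ r → ∀ B y → Simplex r B → goodᵇ B y ≡ true → Simplex r (insert B y)
  good-insert-simplex r≥2 B y sB good = simplex-∪ r (insert B y) (core B) rest split core⊆ rest⊆ apart core-simplex rest-simplex
    where
    rest = insert (loose B) y
    y≁core : anyᶠ (λ t → lookup (core B) t ∧ adj y t) ≡ false
    y≁core = candidate-≁C (core B) y (apex-candidate B y (∧-trueˡ good))
    ∣loose∣≤1 : ∣ loose B ∣ ≤ 1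
    ∣loose∣≤1 = NP.≤ᵇ⇒≤ _ _ (Equivalence.from BP.T-≡ (∧-trueʳ good))
    core⇒∈B : ∀ {i} → i ∈ core B → lookup B i ≡ true
    core⇒∈B m = ∧-trueˡ (trans (sym (lookup-core B _)) (∈⇒lookup m))
    loose-isolated : ∀ j i → lookup B j ≡ true → inCoreᵇ B j ≡ false → lookup B i ≡ true → adj j i ≡ false
    loose-isolated j i j∈B j∉core i∈B with anyᶠ (λ t → (lookup B t ∨ isVᵇ t) ∧ adj j t) in has-neighbour
    ... | true rewrite j∈B = ⊥-elim (true≢false j∉core)
    ... | false = subst (λ b → (b ∨ isVᵇ i) ∧ adj j i ≡ false) i∈B (anyᶠ-false _ has-neighbour i)
    split : ∀ {i} → i ∈ insert B y → i ∈ core B ⊎ i ∈ rest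
    split {i} m with ∈-insert⁻ m
    ... | inj₂ refl = inj₂ ∈-insert-self
    ... | inj₁ i∈B with inCoreᵇ B i in in-core
    ...   | true = inj₁ (lookup⇒∈ (trans (lookup-core B i) in-core))
    ...   | false = inj₂ (∈-insert⁺ (lookup⇒∈ (trans (lookup-loose B i) (cong₂ _∧_ (∈⇒lookup i∈B) (cong not in-core)))))
    core⊆ : core B ⊆ insert B y
    core⊆ m = ∈-insert⁺ (lookup⇒∈ (core⇒∈B m))
    rest⊆ : rest ⊆ insert B y
    rest⊆ m with ∈-insert⁻ m
    ... | inj₂ refl = ∈-insert-self
    ... | inj₁ i∈loose = ∈-insert⁺ (lookup⇒∈ (∧-trueˡ (trans (sym (lookup-loose B _)) (∈⇒lookup i∈loose))))
    apart : ∀ i j → i ∈ core B → j ∈ rest → ¬ Adj G i j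
    apart i j i∈core j∈rest i~j with ∈-insert⁻ j∈rest
    ... | inj₂ refl = true≢false (trans (sym (∧-true (∈⇒lookup i∈core) (Adj-sym i~j))) (anyᶠ-false _ y≁core i))
    ... | inj₁ j∈loose = true≢false (trans (sym (Adj-sym i~j))
                           (loose-isolated j i (∧-trueˡ j-loose) (not-true⁻ (∧-trueʳ j-loose)) (core⇒∈B i∈core)))
      where j-loose = trans (sym (lookup-loose B j)) (∈⇒lookup j∈loose)
    core-simplex : Simplex r (core B)
    core-simplex = simplex-part r B (core B) (λ m → lookup⇒∈ (core⇒∈B m)) no-edges-out sB
      where no-edges-out : NoEdgesOut (core B) B
            no-edges-out i j i∈core j∈B j∉core i~j with inCoreᵇ B j in in-core
            ... | true = j∉core (lookup⇒∈ (trans (lookup-core B j) in-core))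
            ... | false = true≢false (trans (sym (Adj-sym i~j)) (loose-isolated j i (∈⇒lookup j∈B) in-core (core⇒∈B i∈core)))
    rest-simplex : Simplex r rest
    rest-simplex = simplex-small r rest (NP.≤-trans (∣insert∣≤ (loose B) y) (NP.≤-trans (s≤s ∣loose∣≤1) r≥2))

  Ψ-chain : 2 ≤ r → ∀ k z → IsChain G r k z → IsChain G r (suc k) (Ψ z)
  Ψ-chain r≥2 k z chz A nA = sumFin-zero (Ψ-term z A) λ y → bool-cases (lookup A y ∧ goodᵇ (remove A y) y) (on y) (Ψ-term-off z A y)
    where
    on : ∀ y → (lookup A y ∧ goodᵇ (remove A y) y) ≡ true → Ψ-term z A y ≡ 0ℤ
    on y e = trans (Ψ-term-on z A y e) (trans (cong (sgn (below y (remove A y)) *_) z≡0) (ZP.*-zeroʳ (sgn (below y (remove A y)))))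
      where
      y∈A = ∧-trueˡ {lookup A y} e
      z≡0 : z (remove A y) ≡ 0ℤ
      z≡0 = decidable-stable (_ Z.≟ _) λ z≢0 → z≢0 (chz (remove A y) λ (sB , ∣B∣≡k) →
              nA (subst (Simplex r) (insert-remove A y y∈A) (good-insert-simplex r≥2 (remove A y) y sB (∧-trueʳ {lookup A y} e)) ,
                  trans (∣∣≡suc∣remove∣ A y y∈A) (cong suc ∣B∣≡k)))


module TransferBoundary {n : ℕ} (G : Graph n) (r : ℕ) (v : Fin n) (H : ∀ u w → Adj G v u → InN₂ G v w → Adj G u w)
                        (small : ∣ Nbhd G v ∣ < r) where
  open Graph G using (adj)
  open Walks G
  open Supports G v H
  open Transfer G v
  open UnconeableFaces G r v H small

  core≡ : ∀ B S → (∀ i → lookup S i ≡ true → lookup B i ≡ true)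
    → (∀ s → s ∈ S → Σ (Fin n) λ t → t ∈ insert S v × Adj G s t)
    → (∀ b t → lookup B b ≡ true → lookup S b ≡ false → (lookup B t ∨ isVᵇ t) ≡ true → adj b t ≡ false)
    → core B ≡ S
  core≡ B S S⊆B neighbour far = subset-ext (core B) S pt
    where
    pt : ∀ i → lookup (core B) i ≡ lookup S i
    pt i rewrite lookup-core B i with lookup S i in i∈S
    ... | true = ∧-true (S⊆B i i∈S) (anyᶠ-intro _ t (∧-true t∈B∪v (proj₂ (proj₂ (neighbour i (lookup⇒∈ i∈S))))))
      where
      t = proj₁ (neighbour i (lookup⇒∈ i∈S))
      t∈B∪v : (lookup B t ∨ isVᵇ t) ≡ true
      t∈B∪v with ∈-insert⁻ (proj₁ (proj₂ (neighbour i (lookup⇒∈ i∈S))))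
      ... | inj₁ t∈S rewrite S⊆B t (∈⇒lookup t∈S) = refl
      ... | inj₂ e = trans (cong (lookup B t ∨_) (isVᵇ-≡ e)) (BP.∨-zeroʳ _)
    ... | false with lookup B i in i∈B
    ...   | false = refl
    ...   | true = anyᶠ-none _ λ t → bool-cases (lookup B t ∨ isVᵇ t)
                     (λ e → trans (cong (_∧ adj i t) e) (far i t i∈B i∈S e)) (λ e → cong (_∧ adj i t) e)

  -- The first neighbour of y on a walk from v to y is a core vertex adjacent to y.
  support-vertex-not-apex : ∀ S y B → v ∉ S → Connected G (insert S v) → y ∈ S → (∀ t → t ∈ S → t ≢ y → t ∈ B) →
                            selectsᵇ (apex B) y ≡ false
  support-vertex-not-apex S y B v∉S conn y∈S S-y⊆B with selectsᵇ (apex B) y in is-apex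
  ... | false = refl
  ... | true with walk-neighbour-of-end (conn v y ∈-insert-self (∈-insert⁺ y∈S)) (λ { refl → v∉S y∈S })
                                 (λ v~y → true≢false (trans (sym v~y) (candidate-≁v (core B) y candidate)))
    where candidate = apex-candidate B y is-apex
  ... | u , p , u∈S∪v , p∈S∪v , u~y , u~p , p≢y =
    ⊥-elim (true≢false (trans (sym (∧-true u∈core (Adj-sym u~y))) (anyᶠ-false _ (candidate-≁C (core B) y candidate) u)))
    where
    candidate = apex-candidate B y is-apex
    u∈B : u ∈ B
    u∈B = S-y⊆B u (∈-insert-≢ u∈S∪v λ { refl → true≢false (trans (sym u~y) (candidate-≁v (core B) y candidate)) }) (Adj⇒≢ u~y)
    p∈B∪v : (lookup B p ∨ isVᵇ p) ≡ true
    p∈B∪v with ∈-insert⁻ p∈S∪v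
    ... | inj₁ p∈S rewrite ∈⇒lookup (S-y⊆B p p∈S p≢y) = refl
    ... | inj₂ e = trans (cong (lookup B p ∨_) (isVᵇ-≡ e)) (BP.∨-zeroʳ _)
    u∈core : lookup (core B) u ≡ true
    u∈core = trans (lookup-core B u) (∧-true (∈⇒lookup u∈B) (anyᶠ-intro _ p (∧-true p∈B∪v u~p)))

  support-insert-nonSimplex : ∀ S x → v ∉ S → Connected G (insert S v) → ∣ S ∣ ≡ r → lookup S x ≡ false →
         (x ≡ v ⊎ Σ (Fin n) λ t → t ∈ insert S v × Adj G x t) → ¬ Simplex r (insert S x)
  support-insert-nonSimplex S x v∉S conn ∣S∣≡r x∉S (inj₁ refl) = connected-large⇒¬simplex r (insert S v) v ∈-insert-self conn
    (subst (r <_) (sym (trans (∣insert∣ S v x∉S) (cong suc ∣S∣≡r))) (NP.n<1+n r))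
  support-insert-nonSimplex S x v∉S conn ∣S∣≡r x∉S (inj₂ (t , t∈ , x~t)) with x ≟ v
  ... | yes refl = support-insert-nonSimplex S v v∉S conn ∣S∣≡r x∉S (inj₁ refl)
  ... | no x≢v = connected-large⇒¬simplex r (insert S x) x ∈-insert-self S∪x-connected
    (subst (r <_) (sym ∣S∪x∣≡1+r) (NP.n<1+n r))
    where
    ∣S∪x∣≡1+r = trans (∣insert∣ S x x∉S) (cong suc ∣S∣≡r)
    v∉S∪x : v ∉ insert S x
    v∉S∪x m with ∈-insert⁻ m
    ... | inj₁ v∈S = v∉S v∈S
    ... | inj₂ v≡x = x≢v (sym v≡x)
    S∪x-connected : Connected G (insert S x)
    S∪x-connected = large-support-connected (insert S x) v∉S∪x
      (subst (Connected G) (sym (insert-comm S x v)) (connected-insert (insert S v) x t conn t∈ x~t))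
      (subst (∣ Nbhd G v ∣ <_) (sym ∣S∪x∣≡1+r) (NP.m≤n⇒m≤1+n small))

  non-candidate-near : ∀ S x → lookup S x ≡ false → apexCandidateᵇ S x ≡ false →
                       x ≡ v ⊎ Σ (Fin n) λ t → t ∈ insert S v × Adj G x t
  non-candidate-near S x x∉S ¬candidate with isVᵇ x in x≡v
  ... | true = inj₁ (isVᵇ-true x≡v)
  ... | false with adj v x in v~x
  ...   | true = inj₂ (v , ∈-insert-self , Adj-sym v~x)
  ...   | false with anyᶠ (λ t → lookup S t ∧ adj x t) in x~S
  ...     | true = let (t , p) = anyᶠ-witness _ x~S in inj₂ (t , ∈-insert⁺ (lookup⇒∈ (∧-trueˡ p)) , ∧-trueʳ {lookup S t} p)
  ...     | false rewrite x∉S = ⊥-elim (true≢false ¬candidate)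

  Ψ-term-support : ∀ z S A y → v ∉ S → Connected G (insert S v) → y ∈ S → S ⊆ A → Ψ-term z A y ≡ 0ℤ
  Ψ-term-support z S A y v∉S conn y∈S S⊆A = Ψ-term-not-apex z A y
    (support-vertex-not-apex S y (remove A y) v∉S conn y∈S (λ t t∈S t≢y → ∈-remove⁺ (S⊆A t∈S) t≢y))

  module Support (S : Subset n) (v∉S : v ∉ S) (conn : Connected G (insert S v)) where
    core-far : ∀ u → lookup S u ≡ false → (∀ t → t ∈ insert S v → adj u t ≡ false) → core (insert S u) ≡ S
    core-far u u∉S far = core≡ (insert S u) S (λ i e → ∈⇒lookup (∈-insert⁺ {A = S} {x = u} (lookup⇒∈ e)))
                               (λ s s∈S → support-neighbour S v s conn s∈S v∉S) far′
      where
      far′ : ∀ b t → lookup (insert S u) b ≡ true → lookup S b ≡ false → (lookup (insert S u) t ∨ isVᵇ t) ≡ true → adj b t ≡ false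
      far′ b t b∈ b∉S t∈ with b ≟ u
      ... | no b≢u = ⊥-elim (true≢false (trans (sym (trans (sym (lookup-insert-other S u b b≢u)) b∈)) b∉S))
      ... | yes refl with ∨-true⁻ t∈
      ...   | inj₂ t≡v = far t (subst (_∈ insert S v) (sym (isVᵇ-true t≡v)) ∈-insert-self)
      ...   | inj₁ t∈′ with t ≟ b
      ...     | yes refl = Graph.irrefl G t
      ...     | no t≢b = far t (∈-insert⁺ (lookup⇒∈ (trans (sym (lookup-insert-other S b t t≢b)) t∈′)))

    core-self : core S ≡ S
    core-self = core≡ S S (λ i e → e) (λ s s∈S → support-neighbour S v s conn s∈S v∉S)
                      (λ b t b∈ b∉ _ → ⊥-elim (true≢false (trans (sym b∈) b∉)))

    goodᵇ-self : ∀ y → goodᵇ S y ≡ selectsᵇ (apexOf S) y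
    goodᵇ-self y = trans (cong₂ (λ C k → selectsᵇ (apexOf C) y ∧ (k N.≤ᵇ 1)) core-self ∣loose∣≡0) (BP.∧-identityʳ _)
      where ∣loose∣≡0 : ∣ loose S ∣ ≡ 0
            ∣loose∣≡0 = trans (cong ∣_∣ (subset-ext (loose S) S.⊥ pt)) (SP.∣⊥∣≡0 n)
              where pt : ∀ i → lookup (loose S) i ≡ lookup (S.⊥ {n}) i
                    pt i rewrite lookup-loose S i | sym (lookup-core S i) | core-self | lookup-⊥ i = BP.∧-inverseʳ (lookup S i)

    goodᵇ-far : ∀ u → lookup S u ≡ false → (∀ t → t ∈ insert S v → adj u t ≡ false) →
                ∀ y → goodᵇ (insert S u) y ≡ selectsᵇ (apexOf S) y
    goodᵇ-far u u∉S far y =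
      trans (cong₂ (λ C k → selectsᵇ (apexOf C) y ∧ (k N.≤ᵇ 1)) (core-far u u∉S far) ∣loose∣≡1) (BP.∧-identityʳ _)
      where ∣loose∣≡1 : ∣ loose (insert S u) ∣ ≡ 1
            ∣loose∣≡1 = trans (cong ∣_∣ (subset-ext (loose (insert S u)) ⁅ u ⁆ pt)) (SP.∣⁅x⁆∣≡1 u)
              where pt : ∀ i → lookup (loose (insert S u)) i ≡ lookup ⁅ u ⁆ i
                    pt i rewrite lookup-loose (insert S u) i | sym (lookup-core (insert S u) i) | core-far u u∉S far with i ≟ u
                    ... | yes refl rewrite lookup-insert-self S i | u∉S | lookup-⁅x⁆-x i = refl
                    ... | no i≢u rewrite lookup-insert-other S u i i≢u | lookup-⁅x⁆-≢ u i i≢u = BP.∧-inverseʳ (lookup S i)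

    Ψ-insert : ∀ z x → lookup S x ≡ false → Ψ z (insert S x) ≡ (if selectsᵇ (apexOf S) x then sgn (below x S) * z S else 0ℤ)
    Ψ-insert z x x∉S = trans (sumFin-single (Ψ-term z (insert S x)) x others) at-x
      where
      others : ∀ y → y ≢ x → Ψ-term z (insert S x) y ≡ 0ℤ
      others y y≢x = bool-cases (lookup (insert S x) y)
        (λ e → Ψ-term-support z S (insert S x) y v∉S conn (lookup⇒∈ (trans (sym (lookup-insert-other S x y y≢x)) e)) ∈-insert⁺)
        (Ψ-term-∉ z (insert S x) y)
      at-x : Ψ-term z (insert S x) x ≡ (if selectsᵇ (apexOf S) x then sgn (below x S) * z S else 0ℤ)
      at-x rewrite Ψ-term-at z (insert S x) x S (remove-insert S x x∉S) (lookup-insert-self S x) | goodᵇ-self x = refl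

  candidate-far : ∀ {S u} → apexCandidateᵇ S u ≡ true → ∀ t → t ∈ insert S v → adj u t ≡ false
  candidate-far {S} {u} ok t t∈ with ∈-insert⁻ t∈
  ... | inj₁ t∈S = trans (sym (BP.∧-identityˡ (adj u t)))
                         (trans (cong (_∧ adj u t) (sym (∈⇒lookup t∈S))) (anyᶠ-false _ (candidate-≁C S u ok) t))
  ... | inj₂ refl = trans (Graph.sym G u v) (candidate-≁v S u ok)

  far-candidate : ∀ {S w} → lookup S w ≡ false → w ≢ v → (∀ t → t ∈ insert S v → ¬ Adj G w t) → apexCandidateᵇ S w ≡ true
  far-candidate {S} {w} w∉S w≢v far = ∧-true (not-false⁺ w∉S) (∧-true (not-false⁺ (isVᵇ-≢ w≢v))
    (∧-true (not-false⁺ (trans (Graph.sym G v w) (¬Adj⇒adj≡false (far v ∈-insert-self)))) (not-false⁺ (anyᶠ-none _ pt))))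
    where pt : ∀ t → (lookup S t ∧ adj w t) ≡ false
          pt t = bool-cases (lookup S t) (λ e → trans (cong (_∧ adj w t) e) (¬Adj⇒adj≡false (far t (∈-insert⁺ (lookup⇒∈ e)))))
                                         (λ e → cong (_∧ adj w t) e)

  -- Without an apex every coface of S is a non-simplex, so m z(S) = (∂ d)(S) = 0.
  ∂Ψ-support : ∀ z d m → IsChain G r (suc r) d → (∀ A → ∂ d A ≡ + suc m * z A)
      → ∀ S → v ∉ S → ∣ S ∣ ≡ r → Connected G (insert S v) → ∂ (Ψ z) S ≡ z S
  ∂Ψ-support z d m chd ∂d≡mz S v∉S ∣S∣≡r conn with apexOf S in apex≡
  ... | just a = trans (∂-single (Ψ z) S a a∉S others) (trans (cong (sgn (below a S) *_) (trans (Ψ-insert z a a∉S)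
                   (cong (λ q → if selectsᵇ q a then _ else 0ℤ) apex≡))) (trans (cong (sgn (below a S) *_)
                   (if-selectsᵇ-self a (sgn (below a S) * z S) 0ℤ)) (sgn-involutive (below a S) (z S))))
    where
    open Support S v∉S conn
    a∉S : lookup S a ≡ false
    a∉S = candidate-∉ S a (firstᶠ-just (apexCandidateᵇ S) a apex≡)
    others : ∀ x → x ≢ a → lookup S x ≡ false → Ψ z (insert S x) ≡ 0ℤ
    others x x≢a x∉S = trans (Ψ-insert z x x∉S) (trans (cong (λ q → if selectsᵇ q x then _ else 0ℤ) apex≡)
                         (if-selectsᵇ-other a x _ 0ℤ (λ e → x≢a (sym e))))
  ... | nothing = trans (∂-vanishing (Ψ z) S vanish) (sym z≡0)
    where
    open Support S v∉S conn
    vanish : ∀ x → lookup S x ≡ false → Ψ z (insert S x) ≡ 0ℤ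
    vanish x x∉S = trans (Ψ-insert z x x∉S) (cong (λ q → if selectsᵇ q x then _ else 0ℤ) apex≡)
    ∂d≡0 : ∂ d S ≡ 0ℤ
    ∂d≡0 = ∂-vanishing d S λ x x∉S → chd (insert S x) λ (s , _) →
      support-insert-nonSimplex S x v∉S conn ∣S∣≡r x∉S (non-candidate-near S x x∉S (firstᶠ-nothing (apexCandidateᵇ S) apex≡ x)) s
    z≡0 : z S ≡ 0ℤ
    z≡0 = ZP.*-cancelˡ-≡ (+ suc m) (z S) 0ℤ (trans (trans (sym (∂d≡mz S)) ∂d≡0) (sym (ZP.*-zeroʳ (+ suc m))))

  module FarExtension (z : Subset n → ℤ) (chz : IsChain G r (suc r) z) (∂z≡0 : ∀ A → ∂ z A ≡ 0ℤ)
                      {B S w} (shape : SupportWithFar B S w) where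
    open SupportWithFar shape
    open Support S v∉S S∪v-connected

    Sw : Subset n
    Sw = insert S w

    w-far′ : ∀ t → t ∈ insert S v → adj w t ≡ false
    w-far′ t t∈ = ¬Adj⇒adj≡false (w-far t t∈)

    w∈Sw : lookup Sw w ≡ true
    w∈Sw = lookup-insert-self S w

    ∉Sw⇒≢w : ∀ x → lookup Sw x ≡ false → x ≢ w
    ∉Sw⇒≢w x x∉ refl = true≢false (trans (sym w∈Sw) x∉)

    ∉Sw⇒∉S : ∀ x → lookup Sw x ≡ false → lookup S x ≡ false
    ∉Sw⇒∉S x x∉ = trans (sym (lookup-insert-other S w x (∉Sw⇒≢w x x∉))) x∉

    module Apex (a : Fin n) (apex≡a : apexOf S ≡ just a) where
      Ψ-term-new : ∀ x → lookup Sw x ≡ false →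
                   Ψ-term z (insert Sw x) x ≡ (if selectsᵇ (just a) x then sgn (below x Sw) * z Sw else 0ℤ)
      Ψ-term-new x x∉ rewrite Ψ-term-at z (insert Sw x) x Sw (remove-insert Sw x x∉) (lookup-insert-self Sw x)
                            | goodᵇ-far w w∉S w-far′ x | apex≡a = refl

      Ψ-term-far : ∀ x → lookup Sw x ≡ false →
                   Ψ-term z (insert Sw x) w ≡ (if selectsᵇ (just a) w then sgn (below w (insert S x)) * z (insert S x) else 0ℤ)
      Ψ-term-far x x∉ = trans (Ψ-term-at z (insert Sw x) w (insert S x) removed w∈) (bool-cases (apexCandidateᵇ S x) far near)
        where
        x≢w = ∉Sw⇒≢w x x∉
        x∉S = ∉Sw⇒∉S x x∉
        removed : remove (insert Sw x) w ≡ insert S x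
        removed = trans (remove-insert-comm Sw x w x≢w) (cong (λ X → insert X x) (remove-insert S w w∉S))
        w∈ : lookup (insert Sw x) w ≡ true
        w∈ = trans (lookup-insert-other Sw x w (λ e → x≢w (sym e))) w∈Sw
        term = sgn (below w (insert S x)) * z (insert S x)
        far : apexCandidateᵇ S x ≡ true → (if goodᵇ (insert S x) w then term else 0ℤ) ≡ (if selectsᵇ (just a) w then term else 0ℤ)
        far candidate = cong (λ b → if b then term else 0ℤ)
          (trans (goodᵇ-far x x∉S (candidate-far candidate) w) (cong (λ q → selectsᵇ q w) apex≡a))
        near : apexCandidateᵇ S x ≡ false → (if goodᵇ (insert S x) w then term else 0ℤ) ≡ (if selectsᵇ (just a) w then term else 0ℤ)
        near ¬candidate rewrite chz (insert S x) (λ (s , _) →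
                                  support-insert-nonSimplex S x v∉S S∪v-connected ∣S∣≡r x∉S (non-candidate-near S x x∉S ¬candidate) s)
                              | ZP.*-zeroʳ (sgn (below w (insert S x)))
                              = trans (BP.if-eta (goodᵇ (insert S x) w)) (sym (BP.if-eta (selectsᵇ (just a) w)))

      Ψ-insert-far : ∀ x → lookup Sw x ≡ false → Ψ z (insert Sw x) ≡ Ψ-term z (insert Sw x) x + Ψ-term z (insert Sw x) w
      Ψ-insert-far x x∉ = sumFin-pair (Ψ-term z (insert Sw x)) x w (∉Sw⇒≢w x x∉) others
        where others : ∀ y → y ≢ x → y ≢ w → Ψ-term z (insert Sw x) y ≡ 0ℤ
              others y y≢x y≢w = bool-cases (lookup (insert Sw x) y)
                (λ e → Ψ-term-support z S (insert Sw x) y v∉S S∪v-connected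
                         (lookup⇒∈ (trans (sym (lookup-insert-other S w y y≢w)) (trans (sym (lookup-insert-other Sw x y y≢x)) e)))
                         (λ t∈S → ∈-insert⁺ (∈-insert⁺ t∈S)))
                (Ψ-term-∉ z (insert Sw x) y)

      ∂Ψ-apex≢w : a ≢ w → ∂ (Ψ z) Sw ≡ z Sw
      ∂Ψ-apex≢w a≢w = trans (∂-single (Ψ z) Sw a a∉Sw others)
                            (trans (cong (sgn (below a Sw) *_) at-a) (sgn-involutive (below a Sw) (z Sw)))
        where
        a∉Sw : lookup Sw a ≡ false
        a∉Sw = trans (lookup-insert-other S w a a≢w) (candidate-∉ S a (firstᶠ-just (apexCandidateᵇ S) a apex≡a))
        others : ∀ x → x ≢ a → lookup Sw x ≡ false → Ψ z (insert Sw x) ≡ 0ℤ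
        others x x≢a x∉ = trans (Ψ-insert-far x x∉)
          (cong₂ _+_ (trans (Ψ-term-new x x∉) (if-selectsᵇ-other a x _ 0ℤ (λ e → x≢a (sym e))))
                     (trans (Ψ-term-far x x∉) (if-selectsᵇ-other a w _ 0ℤ a≢w)))
        at-a : Ψ z (insert Sw a) ≡ sgn (below a Sw) * z Sw
        at-a = trans (Ψ-insert-far a a∉Sw) (trans
          (cong₂ _+_ (trans (Ψ-term-new a a∉Sw) (if-selectsᵇ-self a _ 0ℤ))
                     (trans (Ψ-term-far a a∉Sw) (if-selectsᵇ-other a w _ 0ℤ a≢w)))
          (ZP.+-identityʳ _))

    -- When w itself is the apex, each term of ∂ (Ψ z) adding x ≠ w cancels the x-term of (∂ z)(S) = 0.
    ∂Ψ-apex≡w : apexOf S ≡ just w → ∂ (Ψ z) Sw ≡ z Sw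
    ∂Ψ-apex≡w apex≡w = begin
      ∂ (Ψ z) Sw                                          ≡⟨ add-∂z ⟩
      sumFin (λ x → ∂-term (Ψ z) Sw x + s * ∂-term z S x) ≡⟨ sumFin-single _ w cancel ⟩
      ∂-term (Ψ z) Sw w + s * ∂-term z S w                ≡⟨ cong₂ _+_ (∂-term-∈ (Ψ z) Sw w w∈Sw) (cong (s *_) (∂-term-∉ z S w w∉S)) ⟩
      0ℤ + s * (s * z Sw)                                 ≡⟨ trans (ZP.+-identityˡ _) (sgn-involutive (below w S) (z Sw)) ⟩
      z Sw                                                ∎
      where
      open ≡-Reasoning
      open Apex w apex≡w
      s = sgn (below w S)
      add-∂z : ∂ (Ψ z) Sw ≡ sumFin (λ x → ∂-term (Ψ z) Sw x + s * ∂-term z S x)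
      add-∂z = sym (trans (sumFin-+ (∂-term (Ψ z) Sw) (λ x → s * ∂-term z S x))
        (trans (cong (_+_ (∂ (Ψ z) Sw)) (trans (sumFin-* s (∂-term z S)) (trans (cong (s *_) (∂z≡0 S)) (ZP.*-zeroʳ s))))
               (ZP.+-identityʳ _)))
      cancel : ∀ x → x ≢ w → ∂-term (Ψ z) Sw x + s * ∂-term z S x ≡ 0ℤ
      cancel x x≢w = bool-cases (lookup Sw x)
        (λ x∈ → cong₂ _+_ (∂-term-∈ (Ψ z) Sw x x∈)
                           (trans (cong (s *_) (∂-term-∈ z S x (trans (sym (lookup-insert-other S w x x≢w)) x∈))) (ZP.*-zeroʳ s)))
        λ x∉ → let x∉S = ∉Sw⇒∉S x x∉ in
          trans (cong₂ _+_
            (trans (∂-term-∉ (Ψ z) Sw x x∉) (cong (sgn (below x Sw) *_) (trans (Ψ-insert-far x x∉)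
              (cong₂ _+_ (trans (Ψ-term-new x x∉) (if-selectsᵇ-other w x _ 0ℤ (λ e → x≢w (sym e))))
                         (trans (Ψ-term-far x x∉) (if-selectsᵇ-self w _ 0ℤ))))))
            (cong (s *_) (∂-term-∉ z S x x∉S)))
          (trans (cong₂ (λ p q → sgn p * (0ℤ + sgn q * z (insert S x)) + s * (sgn (below x S) * z (insert S x)))
                        (below-insert x w S w∉S) (below-insert w x S x∉S))
          (trans (factor (sgn (sucIf (ltᵇ w x) (below x S))) (sgn (sucIf (ltᵇ x w) (below w S))) s (sgn (below x S)) (z (insert S x)))
                 (cong (_* z (insert S x)) (sgn-exchange x w (below x S) (below w S) x≢w))))
        where factor : ∀ p q r t C → p * (0ℤ + q * C) + r * (t * C) ≡ (p * q + r * t) * C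
              factor = solve-∀

    ∂Ψ-far : ∂ (Ψ z) Sw ≡ z Sw
    ∂Ψ-far with apexOf S in apex≡
    ... | nothing = ⊥-elim (true≢false (trans (sym (far-candidate w∉S w≢v w-far)) (firstᶠ-nothing (apexCandidateᵇ S) apex≡ w)))
    ... | just a with a ≟ w
    ...   | yes refl = ∂Ψ-apex≡w apex≡
    ...   | no a≢w = Apex.∂Ψ-apex≢w a apex≡ a≢w

  ∂Ψ-support+far : ∀ z → IsChain G r (suc r) z → (∀ A → ∂ z A ≡ 0ℤ) → ∀ B S w → SupportWithFar B S w → ∂ (Ψ z) B ≡ z B
  ∂Ψ-support+far z chz ∂z≡0 B S w shape =
    subst (λ X → ∂ (Ψ z) X ≡ z X) (sym (SupportWithFar.B≡S∪w shape)) (FarExtension.∂Ψ-far z chz ∂z≡0 shape)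


module TopDegrees {n : ℕ} (G : Graph n) (r : ℕ) (v : Fin n) (H : ∀ u w → Adj G v u → InN₂ G v w → Adj G u w)
                  (small : ∣ Nbhd G v ∣ < r) (r≥2 : 2 ≤ r) where
  open Chains G r
  open Transfer G v
  open TransferChain G r v
  open UnconeableFaces G r v H small
  open TransferBoundary G r v H small

  torsionFree-r : ReducedHomologyTorsionFree G r r
  torsionFree-r zero z () _ _
  torsionFree-r (suc m) z _ (chz , ∂z≡0) (d , chd , ∂d≡mz) =
    boundary-via-cone v r z (chz , ∂z≡0) (Ψ z) (Ψ-chain r≥2 r z chz) λ B v∉B sB ∣B∣≡r ¬s →
      decidable-stable (_ Z.≟ _) do
        conn ← nonSimplex-r⇒connected B v∉B sB ¬s ∣B∣≡r
        pure (∂Ψ-support z d m chd ∂d≡mz B v∉B ∣B∣≡r conn)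

  torsionFree-suc-r : ReducedHomologyTorsionFree G r (suc r)
  torsionFree-suc-r _ z _ (chz , ∂z≡0) _ =
    boundary-via-cone v (suc r) z (chz , ∂z≡0) (Ψ z) (Ψ-chain r≥2 (suc r) z chz) λ B v∉B sB ∣B∣≡1+r ¬s →
      decidable-stable (_ Z.≟ _) do
        (S , w , shape) ← nonSimplex-suc-r⇒support B v∉B sB ¬s ∣B∣≡1+r
        pure (∂Ψ-support+far z chz ∂z≡0 B S w shape)

corollary4p4 : ∀ {n : ℕ} (G : Graph n) (r : ℕ) (v : Fin n) → 1 ≤ r
    → (∀ u w → Adj G v u → InN₂ G v w → Adj G u w)
    → ∣ Nbhd G v ∣ < r
    → SuppConnected G r v
    × (∀ k → k < r → ReducedHomologyVanishes G r k)
    × ReducedHomologyTorsionFree G r r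
    × ReducedHomologyTorsionFree G r (suc r)
corollary4p4 G r v r≥1 H N<r =
    supports-connected r N<r
  , homology-vanishes-below v
  , top-degree r (TopDegrees.torsionFree-r G r v H N<r)
  , top-degree (suc r) (TopDegrees.torsionFree-suc-r G r v H N<r)
  where
  open Walks G
  open Supports G v H
  open Chains G r

  -- For r = 1 the hypothesis |N(v)| < r makes v isolated, and then every cycle cones off.
  top-degree : ∀ k → (2 ≤ r → ReducedHomologyTorsionFree G r k) → ReducedHomologyTorsionFree G r k
  top-degree k torsionFree with 2 N.≤? r
  ... | yes r≥2 = torsionFree r≥2
  ... | no r≱2 = vanishes⇒torsionFree k (isolated⇒homology-vanishes v r≥1 isolated k)
    where isolated : ∀ u → ¬ Adj G v u
          isolated u v~u = NP.<⇒≱ (Adj⇒∣Nbhd∣>0 v~u) (NP.≤-pred (NP.≤-trans N<r (NP.≤-pred (NP.≰⇒> r≱2))))
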